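{- Let $n\ge1$. The map $\phi^{\mathrm{NC}}_B$ is a bijection from $\mathrm{NC}_B(n)$ to $\mathrm{NC}^{\mathrm{NN}}(n)$. Moreover, if $\phi^{\mathrm{NC}}_B(\pi)=(\sigma,X)$ and $X=\{A_1,\dots,A_k\}_<$, then $\operatorname{type}(\pi)=\operatorname{type}(\sigma\setminus X)\,\dot\cup\, T$, where $T=\mathrm{pairing}(X)$ if $k$ is even and $T=\mathrm{pairing}(X\setminus\{A_{(k+1)/2}\})$ if $k$ is odd.
   Context: $[n]=\{1,\dots,n\}$, $[\pm n]=\{\pm1,\dots,\pm n\}$, $\Pi(n)$ = set partitions of $[n]$. An edge of a partition of a set of integers is a pair $(i,j)$, $i<j$, of elements of the same block with no element of that block strictly between them. $\mathrm{NC}(n)$ is the set of $\sigma\in\Pi(n)$ with no two edges $(a,b),(c,d)$ with $a<c<b<d$. A block $B$ of $\sigma\in\Pi(n)$ is nonnested if there is no edge $(i,j)$ of $\sigma$ with $i<\min B\le\max B<j$. $\mathrm{NC}^{\mathrm{NN}}(n)=\{(\sigma,X):\sigma\in\mathrm{NC}(n),\ X \text{ a set of nonnested blocks of }\sigma\}$. A partition of type $B_n$ is a set partition $\pi$ of $[\pm n]$ such that $-B$ is a block whenever $B$ is, with at most one block (zero block) satisfying $B=-B$. Given a total order $a_1\prec\cdots\prec a_N$ of a finite set $U$, a partition of $U$ is noncrossing with respect to it if there are no $i<j<k<l$ with $a_i,a_k\in B$, $a_j,a_l\in B'$ for blocks $B\ne B'$. $\mathrm{NC}_B(n)$ is the set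 of partitions of type $B_n$ noncrossing with respect to $1\prec2\prec\cdots\prec n\prec-1\prec-2\prec\cdots\prec-n$. For $\pi\in\mathrm{NC}_B(n)$, $\phi^{\mathrm{NC}}_B(\pi)=(\sigma,X)$ where $\sigma\in\Pi(n)$ is obtained from $\pi$ by deleting all negative integers (i.e. its blocks are the nonempty sets of positive elements of blocks of $\pi$), and $X$ is the set of blocks of $\sigma$ properly contained in some block of $\pi$. Types: the type of a collection of finite sets is the multiset of their sizes; the type of $\pi\in\Pi_B(n)$ is the multiset containing $i$ with multiplicity equal to the number of unordered pairs $\{B,-B\}$ of nonzero blocks of $\pi$ of size $i$. $\sigma\setminus X$ denotes the set of blocks of $\sigma$ not in $X$, and $\dot\cup$ denotes multiset union. Writing $\{A_1,\dots,A_k\}_<$ means $\max A_1<\cdots<\max A_k$. For a set $X=\{A_1,\dots,A_{2m}\}_<$ of an even number of disjoint sets, $\mathrm{pairing}(X)$ is the multiset $\{|A_1\cup A_{2m}|,|A_2\cup A_{2m-1}|,\dots,|A_m\cup A_{m+1}|\}$. -}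

module Defs where

open import Data.Bool using (Bool; true; false; _∧_; _∨_; not; if_then_else_)
open import Data.Nat using (ℕ; zero; suc; _+_; _≤_; _<_; _≤ᵇ_; _<ᵇ_; _/_)
open import Data.Fin using (Fin; toℕ)
open import Data.List using (List; []; _∷_; map; filterᵇ; length; _++_; take; drop; reverse; zip)
open import Data.Bool.ListAction using (all; any)
open import Data.List.Relation.Binary.Permutation.Propositional using (_↭_)
open import Data.Product using (Σ; _×_; _,_; proj₁; proj₂)
open import Relation.Binary.PropositionalEquality using (_≡_)

allF : (n : ℕ) → List (Fin n)
allF n = Data.List.allFin n

countF : (n : ℕ) → (Fin n → Bool) → ℕ
countF n p = length (filterᵇ p (allF n))

-- Element i : Fin n stands for the integer
-- toℕ i + 1 (so the order on Fin n is the usual order on [n]).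
-- A set partition is given by its "same block" relation σ i j (a
-- Bool-valued equivalence relation); two partitions are equal iff
-- their relations agree pointwise.

PRel : ℕ → Set
PRel n = Fin n → Fin n → Bool

IsSetPartition : (n : ℕ) → PRel n → Set
IsSetPartition n σ =
  (∀ i → σ i i ≡ true) ×
  (∀ i j → σ i j ≡ true → σ j i ≡ true) ×
  (∀ i j k → σ i j ≡ true → σ j k ≡ true → σ i k ≡ true)

Edge : {n : ℕ} → PRel n → Fin n → Fin n → Set
Edge {n} σ i j =
  toℕ i < toℕ j × σ i j ≡ true ×
  (∀ k → toℕ i < toℕ k → toℕ k < toℕ j → σ i k ≡ false)

IsNC : (n : ℕ) → PRel n → Set
IsNC n σ = IsSetPartition n σ ×
  (∀ a b c d → Edge σ a b → Edge σ c d →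
     toℕ a < toℕ c → toℕ c < toℕ b → toℕ b < toℕ d → Data.Empty.⊥)
  where import Data.Empty

-- The block of σ containing r is nonnested: there is no edge (i , j)
-- with i < min B ≤ max B < j, i.e. with i < b < j for every b ∈ B.
NonNested : {n : ℕ} → PRel n → Fin n → Set
NonNested {n} σ r =
  ∀ i j → Edge σ i j →
  (∀ b → σ r b ≡ true → toℕ i < toℕ b × toℕ b < toℕ j) → Data.Empty.⊥
  where import Data.Empty

-- A pair (σ , X): X, a set of blocks of σ, is encoded as the
-- indicator function of (the union of) its blocks, constant on blocks.
NNData : ℕ → Set
NNData n = PRel n × (Fin n → Bool)

IsNCNN : (n : ℕ) → NNData n → Set
IsNCNN n (σ , X) = IsNC n σ ×
  (∀ i j → σ i j ≡ true → X i ≡ X j) ×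
  (∀ i → X i ≡ true → NonNested σ i)

_≈NN_ : {n : ℕ} → NNData n → NNData n → Set
(σ , X) ≈NN (σ' , X') = (∀ i j → σ i j ≡ σ' i j) × (∀ i → X i ≡ X' i)

-- Elements of [±n]: pos i = toℕ i + 1, neg i = -(toℕ i + 1).

data PM (n : ℕ) : Set where
  pos : Fin n → PM n
  neg : Fin n → PM n

allPM : (n : ℕ) → List (PM n)
allPM n = map pos (allF n) ++ map neg (allF n)

negate : {n : ℕ} → PM n → PM n
negate (pos i) = neg i
negate (neg i) = pos i

-- position in the total order 1 ≺ 2 ≺ ⋯ ≺ n ≺ -1 ≺ -2 ≺ ⋯ ≺ -n
rank : {n : ℕ} → PM n → ℕ
rank (pos i) = toℕ i
rank {n} (neg i) = n + toℕ i

BRel : ℕ → Set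
BRel n = PM n → PM n → Bool

_≈B_ : {n : ℕ} → BRel n → BRel n → Set
π ≈B π' = ∀ x y → π x y ≡ π' x y

IsTypeB : (n : ℕ) → BRel n → Set
IsTypeB n π =
  (∀ x → π x x ≡ true) ×
  (∀ x y → π x y ≡ true → π y x ≡ true) ×
  (∀ x y z → π x y ≡ true → π y z ≡ true → π x z ≡ true) ×
  -- -B is a block whenever B is
  (∀ x y → π x y ≡ π (negate x) (negate y)) ×
  -- at most one zero block (a block B with B = -B, i.e. x ~ -x)
  (∀ x y → π x (negate x) ≡ true → π y (negate y) ≡ true → π x y ≡ true)

IsNCB : (n : ℕ) → BRel n → Set
IsNCB n π = IsTypeB n π ×
  (∀ a b c d → rank a < rank b → rank b < rank c → rank c < rank d →
     π a c ≡ true → π b d ≡ true → π a b ≡ true)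

-- φ^NC_B : σ = restriction of π to positive elements; X = blocks of σ
-- properly contained in a block of π, i.e. (as the block of π
-- containing the σ-block of i is the block of pos i, and its
-- positive part is exactly the σ-block) those i whose π-block
-- contains a negative element.
phiB : (n : ℕ) → BRel n → NNData n
phiB n π = (λ i j → π (pos i) (pos j)) ,
           (λ i → any (λ k → π (pos i) (neg k)) (allF n))

-- Types (multisets of sizes, as lists compared up to permutation)

blockSize : {n : ℕ} → PRel n → Fin n → ℕ
blockSize {n} σ r = countF n (σ r)

isMinB : {n : ℕ} → PRel n → Fin n → Bool
isMinB {n} σ r = all (λ j → not (σ r j) ∨ (toℕ r ≤ᵇ toℕ j)) (allF n)

isMaxB : {n : ℕ} → PRel n → Fin n → Bool
isMaxB {n} σ r = all (λ j → not (σ r j) ∨ (toℕ j ≤ᵇ toℕ r)) (allF n)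

-- type(σ \ X): sizes of the blocks of σ not in X (one per block,
-- the block being represented by its minimum)
typeRest : {n : ℕ} → NNData n → List ℕ
typeRest {n} (σ , X) =
  map (blockSize σ) (filterᵇ (λ i → not (X i) ∧ isMinB σ i) (allF n))

-- the blocks of X listed as A₁ , … , A_k with max A₁ < ⋯ < max A_k
-- (each block represented by its maximum)
blocksX : {n : ℕ} → NNData n → List (Fin n)
blocksX {n} (σ , X) = filterᵇ (λ i → X i ∧ isMaxB σ i) (allF n)

-- [A₁,…,A₂ₘ] ↦ [(A₁,A₂ₘ),(A₂,A₂ₘ₋₁),…,(Aₘ,Aₘ₊₁)]
pairUp : {A : Set} → List A → List (A × A)
pairUp xs = zip (take (length xs / 2) xs) (reverse (drop (length xs / 2) xs))

unionSize : {n : ℕ} → PRel n → Fin n × Fin n → ℕ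
unionSize {n} σ (r , r') = countF n (λ j → σ r j ∨ σ r' j)

pairing : {n : ℕ} → PRel n → List (Fin n) → List ℕ
pairing σ xs = map (unionSize σ) (pairUp xs)

isEven : ℕ → Bool
isEven zero = true
isEven (suc zero) = false
isEven (suc (suc k)) = isEven k

-- delete A_{(k+1)/2} from [A₁,…,A_k] (k odd): 0-based index k / 2
dropMiddle : {A : Set} → List A → List A
dropMiddle xs = take (length xs / 2) xs ++ drop (suc (length xs / 2)) xs

Tpart : {n : ℕ} → NNData n → List ℕ
Tpart (σ , X) =
  let xs = blocksX (σ , X) in
  if isEven (length xs) then pairing σ xs else pairing σ (dropMiddle xs)

-- type(π) for π of type B_n: one entry per pair {B , -B} of nonzero
-- blocks, namely |B|.  The pair is represented by the ≺-least element
-- x of B ∪ -B (x nonzero-block: x ≁ -x).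
isPairRep : {n : ℕ} → BRel n → PM n → Bool
isPairRep {n} π x =
  not (π x (negate x)) ∧
  all (λ y → not (π x y ∨ π (negate x) y) ∨ (rank x ≤ᵇ rank y)) (allPM n)

typeB : {n : ℕ} → BRel n → List ℕ
typeB {n} π =
  map (λ x → length (filterᵇ (π x) (allPM n)))
      (filterᵇ (isPairRep π) (allPM n))

module Submission where

-- For (σ , X) ∈ NC^NN(n) the nonnested X-blocks of the noncrossing σ lie
-- side by side, A₁ < ⋯ < A_k; let index(i) = p when i ∈ A_{p+1}.  The key
-- fact is that for π ∈ NC_B(n) with φ(π) = (σ , X)
--     i ~π -j   ⇔   i , j ∈ X  and  index(i) + index(j) + 1 = k,
-- i.e. the block of π through A_{p+1} is A_{p+1} ∪ -A_{k-p}.  So π is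
-- determined by φ(π) (injectivity), gluing A_{p+1} to -A_{k-p} always gives
-- an element of NC_B(n) (surjectivity), and the pairs {B , -B} of nonzero
-- blocks are the blocks of σ \ X and the unions A_{p+1} ∪ -A_{k-p} with
-- 2p + 1 < k (type formula).

open import Defs
open import Data.Nat using (ℕ; _≤_)
open import Data.Product using (Σ; _×_; _,_)
open import Data.List using (_++_)
open import Data.List.Relation.Binary.Permutation.Propositional using (_↭_)

open import Data.Bool using (Bool; true; false; _∧_; _∨_; not; if_then_else_; T; T?)
open import Data.Bool.Properties using (T-≡; ∧-zeroʳ)
open import Data.Bool.ListAction using (all; any)
open import Data.Empty using (⊥; ⊥-elim)
open import Data.Unit using (tt)
open import Data.Sum using (_⊎_; inj₁; inj₂)
open import Data.Product using (proj₁; proj₂; ∃-syntax)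
open import Data.Nat using (zero; suc; _+_; _∸_; _<_; _≤ᵇ_; _<ᵇ_; _≡ᵇ_; z≤n; s≤s; s≤s⁻¹; _/_)
open import Data.Nat.Properties
open import Data.Nat.DivMod using (m/n≡1+[m∸n]/n)
open import Data.Fin using (Fin; toℕ)
import Data.Fin as Fin
open import Data.Fin.Properties using (toℕ-injective; toℕ<n)
open import Data.List using (List; []; _∷_; map; filterᵇ; length; upTo; applyUpTo; take; drop; reverse; zip; allFin)
open import Data.List.Properties
  using (filter-++; length-++; length-map; length-take; length-drop;
         length-reverse; length-upTo; unfold-reverse; map-tabulate; map-cong-local; map-∘; map-++; ++-identityʳ)
open import Data.List.Membership.Propositional using (_∈_; _∉_)
open import Data.List.Membership.Propositional.Properties
  using (∈-filter⁺; ∈-filter⁻; ∈-allFin; ∈-upTo⁺; ∈-upTo⁻; ∈-map⁺; ∈-++⁺ˡ; ∈-++⁺ʳ; ∈-++⁻; ∈-∃++)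
open import Data.List.Relation.Unary.Any using (here; there)
open import Data.List.Relation.Unary.All using (_∷_) renaming (lookup to All-lookup; tabulate to All-tabulate)
open import Data.List.Relation.Unary.All.Properties using (applyUpTo⁺₁)
open import Data.List.Relation.Unary.AllPairs using (_∷_)
open import Data.List.Relation.Unary.Unique.Propositional using (Unique)
open import Data.List.Relation.Unary.Unique.Propositional.Properties using (allFin⁺; upTo⁺; filter⁺)
open import Data.List.Relation.Binary.Permutation.Propositional using (↭-refl; ↭-sym; ↭-trans; ↭-reflexive; prep; module PermutationReasoning)
open import Data.List.Relation.Binary.Permutation.Propositional.Properties
  using (shift; ↭-length) renaming (map⁺ to ↭-map⁺; ++⁺ to ↭-++⁺)
open import Data.Maybe using (Maybe; just; nothing)
import Data.Maybe as Maybe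
open import Function using (_∘_; id)
open import Function.Bundles using (Equivalence)
open import Relation.Binary.Definitions using (tri<; tri≈; tri>)
open import Relation.Binary.PropositionalEquality
  using (_≡_; _≢_; refl; sym; trans; cong; cong₂; subst; module ≡-Reasoning)
open import Relation.Nullary using (¬_)

true≢false : true ≢ false
true≢false ()

bool-cases : ∀ b → b ≡ true ⊎ b ≡ false
bool-cases true = inj₁ refl
bool-cases false = inj₂ refl

∧-elimˡ : ∀ {a b} → a ∧ b ≡ true → a ≡ true
∧-elimˡ {true} _ = refl

∧-elimʳ : ∀ {a b} → a ∧ b ≡ true → b ≡ true
∧-elimʳ {true} e = e

∧-intro : ∀ {a b} → a ≡ true → b ≡ true → a ∧ b ≡ true
∧-intro refl refl = refl

∨-elim : ∀ {a b} → a ∨ b ≡ true → a ≡ true ⊎ b ≡ true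
∨-elim {true} _ = inj₁ refl
∨-elim {false} e = inj₂ e

∨-introˡ : ∀ {a b} → a ≡ true → a ∨ b ≡ true
∨-introˡ refl = refl

∨-introʳ : ∀ {a b} → b ≡ true → a ∨ b ≡ true
∨-introʳ {true} _ = refl
∨-introʳ {false} e = e

not-elim : ∀ {a} → not a ≡ true → a ≡ false
not-elim {false} _ = refl

not-intro : ∀ {a} → a ≡ false → not a ≡ true
not-intro refl = refl

≢true⇒false : ∀ {a} → ¬ (a ≡ true) → a ≡ false
≢true⇒false {true} h = ⊥-elim (h refl)
≢true⇒false {false} _ = refl

false⇒≢true : ∀ {a} → a ≡ false → ¬ (a ≡ true)
false⇒≢true refl ()

bool-ext : ∀ {a b} → (a ≡ true → b ≡ true) → (b ≡ true → a ≡ true) → a ≡ b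
bool-ext {true} {true} _ _ = refl
bool-ext {true} {false} f _ = sym (f refl)
bool-ext {false} {true} _ g = g refl
bool-ext {false} {false} _ _ = refl

≡true⇒T : ∀ {a} → a ≡ true → T a
≡true⇒T = Equivalence.from T-≡

T⇒≡true : ∀ {a} → T a → a ≡ true
T⇒≡true = Equivalence.to T-≡

<ᵇ-sound : ∀ {m n} → (m <ᵇ n) ≡ true → m < n
<ᵇ-sound {m} {n} e = <ᵇ⇒< m n (≡true⇒T e)

<ᵇ-complete : ∀ {m n} → m < n → (m <ᵇ n) ≡ true
<ᵇ-complete m<n = T⇒≡true (<⇒<ᵇ m<n)

≤ᵇ-sound : ∀ {m n} → (m ≤ᵇ n) ≡ true → m ≤ n
≤ᵇ-sound {m} {n} e = ≤ᵇ⇒≤ m n (≡true⇒T e)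

≤ᵇ-complete : ∀ {m n} → m ≤ n → (m ≤ᵇ n) ≡ true
≤ᵇ-complete m≤n = T⇒≡true (≤⇒≤ᵇ m≤n)

≡ᵇ-sound : ∀ {m n} → (m ≡ᵇ n) ≡ true → m ≡ n
≡ᵇ-sound {m} {n} e = ≡ᵇ⇒≡ m n (≡true⇒T e)

≡ᵇ-complete : ∀ {m n} → m ≡ n → (m ≡ᵇ n) ≡ true
≡ᵇ-complete {m} {n} e = T⇒≡true (≡⇒≡ᵇ m n e)

count : {A : Set} → (A → Bool) → List A → ℕ
count p xs = length (filterᵇ p xs)

module _ {A : Set} {p : A → Bool} where

  count-none : ∀ xs → (∀ x → x ∈ xs → p x ≡ false) → count p xs ≡ 0
  count-none [] _ = refl
  count-none (x ∷ xs) h rewrite h x (here refl) = count-none xs (λ y m → h y (there m))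

  count-pos⇒witness : ∀ xs → 0 < count p xs → ∃[ x ] (x ∈ xs × p x ≡ true)
  count-pos⇒witness (x ∷ xs) 0<c with p x in px
  ... | true = x , here refl , px
  ... | false with count-pos⇒witness xs 0<c
  ...   | y , y∈ , py = y , there y∈ , py

  count-single : ∀ {y} xs → Unique xs → y ∈ xs → p y ≡ true →
                 (∀ x → p x ≡ true → x ≡ y) → count p xs ≡ 1
  count-single (x ∷ xs) (x∉ ∷ _) (here refl) py only rewrite py =
    cong suc (count-none xs λ z z∈ → ≢true⇒false λ pz → All-lookup x∉ z∈ (sym (only z pz)))
  count-single (x ∷ xs) (x∉ ∷ u) (there y∈) py only
    rewrite ≢true⇒false {p x} (λ px → All-lookup x∉ y∈ (only x px)) = count-single xs u y∈ py only

count-mono : {A : Set} {p q : A → Bool} → (∀ x → p x ≡ true → q x ≡ true) →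
             ∀ xs → count p xs ≤ count q xs
count-mono h [] = z≤n
count-mono {p = p} {q} h (x ∷ xs) with p x in px | q x in qx
... | true  | true  = s≤s (count-mono h xs)
... | true  | false = ⊥-elim (true≢false (trans (sym (h x px)) qx))
... | false | true  = m≤n⇒m≤1+n (count-mono h xs)
... | false | false = count-mono h xs

count-ext : {A : Set} {p q : A → Bool} → (∀ x → p x ≡ true → q x ≡ true) →
            (∀ x → q x ≡ true → p x ≡ true) → ∀ xs → count p xs ≡ count q xs
count-ext h g xs = ≤-antisym (count-mono h xs) (count-mono g xs)

count-strict : {A : Set} {p q : A → Bool} → (∀ x → p x ≡ true → q x ≡ true) →
               ∀ {y} xs → y ∈ xs → q y ≡ true → p y ≡ false → count p xs < count q xs
count-strict h (x ∷ xs) (here refl) qy py rewrite qy | py = s≤s (count-mono h xs)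
count-strict {p = p} {q} h (x ∷ xs) (there y∈) qy py with p x in px | q x in qx
... | true  | true  = s≤s (count-strict h xs y∈ qy py)
... | true  | false = ⊥-elim (true≢false (trans (sym (h x px)) qx))
... | false | true  = m<n⇒m<1+n (count-strict h xs y∈ qy py)
... | false | false = count-strict h xs y∈ qy py

count-split : {A : Set} (p q : A → Bool) → ∀ xs →
  count p xs ≡ count (λ x → p x ∧ q x) xs + count (λ x → p x ∧ not (q x)) xs
count-split p q [] = refl
count-split p q (x ∷ xs) with p x | q x
... | false | _     = count-split p q xs
... | true  | true  = cong suc (count-split p q xs)
... | true  | false = trans (cong suc (count-split p q xs)) (sym (+-suc _ _))

count-disjoint-∨ : {A : Set} (p q : A → Bool) → (∀ x → p x ≡ true → q x ≡ true → ⊥) →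
  ∀ xs → count (λ x → p x ∨ q x) xs ≡ count p xs + count q xs
count-disjoint-∨ p q dj [] = refl
count-disjoint-∨ p q dj (x ∷ xs) with p x in px | q x in qx
... | true  | true  = ⊥-elim (dj x px qx)
... | true  | false = cong suc (count-disjoint-∨ p q dj xs)
... | false | true  = trans (cong suc (count-disjoint-∨ p q dj xs)) (sym (+-suc _ _))
... | false | false = count-disjoint-∨ p q dj xs

count-++ : {A : Set} (p : A → Bool) → ∀ xs ys → count p (xs ++ ys) ≡ count p xs + count p ys
count-++ p xs ys = trans (cong length (filter-++ (T? ∘ p) xs ys)) (length-++ (filterᵇ p xs))

filterᵇ-map : {A B : Set} (f : A → B) (p : B → Bool) → ∀ xs →
              filterᵇ p (map f xs) ≡ map f (filterᵇ (p ∘ f) xs)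
filterᵇ-map f p [] = refl
filterᵇ-map f p (x ∷ xs) with p (f x)
... | true  = cong (f x ∷_) (filterᵇ-map f p xs)
... | false = filterᵇ-map f p xs

filterᵇ-cong : {A : Set} {p q : A → Bool} → (∀ x → p x ≡ q x) → ∀ xs → filterᵇ p xs ≡ filterᵇ q xs
filterᵇ-cong h [] = refl
filterᵇ-cong {p = p} {q} h (x ∷ xs) with p x | q x | h x
... | true  | .true  | refl = cong (x ∷_) (filterᵇ-cong h xs)
... | false | .false | refl = filterᵇ-cong h xs

count-map : {A B : Set} (f : A → B) (p : B → Bool) → ∀ xs → count p (map f xs) ≡ count (p ∘ f) xs
count-map f p xs = trans (cong length (filterᵇ-map f p xs)) (length-map f (filterᵇ (p ∘ f) xs))

module _ {A : Set} {p : A → Bool} where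

  any-witness : ∀ xs → any p xs ≡ true → ∃[ x ] (x ∈ xs × p x ≡ true)
  any-witness (x ∷ xs) e with p x in px
  ... | true = x , here refl , px
  ... | false with any-witness xs e
  ...   | y , y∈ , py = y , there y∈ , py

  any-intro : ∀ {x} xs → x ∈ xs → p x ≡ true → any p xs ≡ true
  any-intro (x ∷ xs) (here refl) px rewrite px = refl
  any-intro (x ∷ xs) (there x∈) px = ∨-introʳ {p x} (any-intro xs x∈ px)

  any-false : ∀ {x} xs → x ∈ xs → any p xs ≡ false → p x ≡ false
  any-false xs x∈ e = ≢true⇒false λ px → true≢false (trans (sym (any-intro xs x∈ px)) e)

  all-elim : ∀ {x} xs → x ∈ xs → all p xs ≡ true → p x ≡ true
  all-elim (y ∷ xs) (here refl) e = ∧-elimˡ e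
  all-elim (y ∷ xs) (there x∈) e = all-elim xs x∈ (∧-elimʳ {p y} e)

  all-intro : ∀ xs → (∀ x → x ∈ xs → p x ≡ true) → all p xs ≡ true
  all-intro [] _ = refl
  all-intro (x ∷ xs) h = ∧-intro (h x (here refl)) (all-intro xs (λ y m → h y (there m)))

all-cong : {A : Set} {p q : A → Bool} → (∀ x → p x ≡ q x) → ∀ xs → all p xs ≡ all q xs
all-cong h [] = refl
all-cong h (x ∷ xs) = cong₂ _∧_ (h x) (all-cong h xs)

only-head : {A : Set} {p : A → Bool} {z x : A} (zs : List A) →
            any p zs ≡ false → x ∈ z ∷ zs → p x ≡ true → x ≡ z
only-head zs _ (here refl) _ = refl
only-head {p = p} zs none (there x∈) px = ⊥-elim (true≢false (trans (sym px) (any-false {p = p} zs x∈ none)))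

module Extremal {A : Set} (_⊑_ : A → A → Set) (⊑-total : ∀ a b → a ⊑ b ⊎ b ⊑ a)
                (⊑-refl : ∀ {a} → a ⊑ a) (⊑-trans : ∀ {a b c} → a ⊑ b → b ⊑ c → a ⊑ c) where

  greatest : (p : A → Bool) → ∀ xs {x} → x ∈ xs → p x ≡ true →
             ∃[ m ] (m ∈ xs × p m ≡ true × (∀ y → y ∈ xs → p y ≡ true → y ⊑ m))
  greatest p (z ∷ zs) x∈ px with any p zs in some
  ... | false = z , here refl , subst (λ w → p w ≡ true) (only-head zs some x∈ px) px ,
                λ y y∈ py → subst (_⊑ z) (sym (only-head zs some y∈ py)) ⊑-refl
  ... | true with any-witness zs some
  ... | w , w∈ , pw with greatest p zs w∈ pw
  ... | m , m∈ , pm , below-m with p z in pz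
  ...   | false = m , there m∈ , pm , λ where
            y (here refl) py → ⊥-elim (true≢false (trans (sym py) pz))
            y (there y∈) py → below-m y y∈ py
  ...   | true with ⊑-total z m
  ...     | inj₁ z⊑m = m , there m∈ , pm , λ where
              y (here refl) _ → z⊑m
              y (there y∈) py → below-m y y∈ py
  ...     | inj₂ m⊑z = z , here refl , pz , λ where
              y (here refl) _ → ⊑-refl
              y (there y∈) py → ⊑-trans (below-m y y∈ py) m⊑z

latest : {n : ℕ} (p : Fin n → Bool) → ∀ xs {x} → x ∈ xs → p x ≡ true →
         ∃[ m ] (m ∈ xs × p m ≡ true × (∀ y → y ∈ xs → p y ≡ true → toℕ y ≤ toℕ m))
latest = Extremal.greatest (λ a b → toℕ a ≤ toℕ b) (λ a b → ≤-total (toℕ a) (toℕ b)) ≤-refl ≤-trans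

earliest : {n : ℕ} (p : Fin n → Bool) → ∀ xs {x} → x ∈ xs → p x ≡ true →
           ∃[ m ] (m ∈ xs × p m ≡ true × (∀ y → y ∈ xs → p y ≡ true → toℕ m ≤ toℕ y))
earliest = Extremal.greatest (λ a b → toℕ b ≤ toℕ a) (λ a b → ≤-total (toℕ b) (toℕ a)) ≤-refl (λ p q → ≤-trans q p)

firstWith : {A : Set} → (A → Bool) → A → List A → A
firstWith p d [] = d
firstWith p d (x ∷ xs) = if p x then x else firstWith p d xs

firstWith-satisfies : {A : Set} (p : A → Bool) → ∀ xs d {x} → x ∈ xs → p x ≡ true →
                      p (firstWith p d xs) ≡ true
firstWith-satisfies p (y ∷ ys) d x∈ px with p y in py
... | true = py
firstWith-satisfies p (y ∷ ys) d (here refl) px | false = ⊥-elim (true≢false (trans (sym px) py))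
firstWith-satisfies p (y ∷ ys) d (there x∈) px | false = firstWith-satisfies p ys d x∈ px

∈-insert : {A : Set} (ys₁ : List A) {y w : A} {ys₂ : List A} → w ∈ ys₁ ++ ys₂ → w ∈ ys₁ ++ y ∷ ys₂
∈-insert ys₁ w∈ with ∈-++⁻ ys₁ w∈
... | inj₁ w∈₁ = ∈-++⁺ˡ w∈₁
... | inj₂ w∈₂ = ∈-++⁺ʳ ys₁ (there w∈₂)

∈-remove : {A : Set} (ys₁ : List A) {y w : A} {ys₂ : List A} → w ∈ ys₁ ++ y ∷ ys₂ → w ≢ y → w ∈ ys₁ ++ ys₂
∈-remove ys₁ w∈ w≢y with ∈-++⁻ ys₁ w∈
... | inj₁ w∈₁ = ∈-++⁺ˡ w∈₁
... | inj₂ (here refl) = ⊥-elim (w≢y refl)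
... | inj₂ (there w∈₂) = ∈-++⁺ʳ ys₁ w∈₂

unique-remove : {A : Set} (ys₁ : List A) {y : A} {ys₂ : List A} →
                Unique (ys₁ ++ y ∷ ys₂) → Unique (ys₁ ++ ys₂) × y ∉ ys₁ ++ ys₂
unique-remove [] (y∉ ∷ u) = u , λ y∈ → All-lookup y∉ y∈ refl
unique-remove (z ∷ zs) (z∉ ∷ u) with unique-remove zs u
... | u' , y∉ = All-tabulate (λ w∈ → All-lookup z∉ (∈-insert zs w∈)) ∷ u' , λ where
        (here refl) → All-lookup z∉ (∈-++⁺ʳ zs (here refl)) refl
        (there y∈) → y∉ y∈

↭-from-bijection : {A B C : Set} (w : A → C) (w' : B → C) (h : A → B) → ∀ xs ys →
  Unique xs → Unique ys →
  (∀ {x} → x ∈ xs → h x ∈ ys) →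
  (∀ {x x'} → x ∈ xs → x' ∈ xs → h x ≡ h x' → x ≡ x') →
  (∀ {y} → y ∈ ys → ∃[ x ] (x ∈ xs × h x ≡ y)) →
  (∀ {x} → x ∈ xs → w' (h x) ≡ w x) →
  map w xs ↭ map w' ys
↭-from-bijection w w' h [] [] _ _ _ _ _ _ = ↭-refl
↭-from-bijection w w' h [] (y ∷ ys) _ _ _ _ onto _ with onto (here refl)
... | _ , () , _
↭-from-bijection w w' h (x ∷ xs) ys (x∉ ∷ ux) uy into inj onto weight with ∈-∃++ (into (here refl))
... | ys₁ , ys₂ , refl with unique-remove ys₁ uy
... | uy' , hx∉ = ↭-trans (prep (w x) rest) (subst (λ c → c ∷ map w' (ys₁ ++ ys₂) ↭ map w' (ys₁ ++ h x ∷ ys₂))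
                                                    (weight (here refl)) (↭-sym (↭-map⁺ w' (shift (h x) ys₁ ys₂))))
  where
  onto' : ∀ {y} → y ∈ ys₁ ++ ys₂ → ∃[ x' ] (x' ∈ xs × h x' ≡ y)
  onto' y∈ with onto (∈-insert ys₁ y∈)
  ... | _ , here refl , refl = ⊥-elim (hx∉ y∈)
  ... | x' , there x'∈ , e = x' , x'∈ , e
  rest : map w xs ↭ map w' (ys₁ ++ ys₂)
  rest = ↭-from-bijection w w' h xs (ys₁ ++ ys₂) ux uy'
    (λ x'∈ → ∈-remove ys₁ (into (there x'∈)) (λ e → All-lookup x∉ x'∈ (inj (here refl) (there x'∈) (sym e))))
    (λ m m' e → inj (there m) (there m') e) onto' (λ m → weight (there m))

filterᵇ-∨-↭ : {A : Set} (p q : A → Bool) → (∀ x → p x ≡ true → q x ≡ true → ⊥) →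
  ∀ xs → filterᵇ (λ x → p x ∨ q x) xs ↭ filterᵇ p xs ++ filterᵇ q xs
filterᵇ-∨-↭ p q dj [] = ↭-refl
filterᵇ-∨-↭ p q dj (x ∷ xs) with p x in px | q x in qx
... | true  | true  = ⊥-elim (dj x px qx)
... | true  | false = prep x (filterᵇ-∨-↭ p q dj xs)
... | false | true  = ↭-trans (prep x (filterᵇ-∨-↭ p q dj xs)) (↭-sym (shift x (filterᵇ p xs) (filterᵇ q xs)))
... | false | false = filterᵇ-∨-↭ p q dj xs

_!?_ : {A : Set} → List A → ℕ → Maybe A
[] !? p = nothing
(x ∷ xs) !? zero = just x
(x ∷ xs) !? suc p = xs !? p

at : {A : Set} → A → List A → ℕ → A
at d xs p = Maybe.fromMaybe d (xs !? p)

!?-ext : {A : Set} (xs ys : List A) → (∀ p → xs !? p ≡ ys !? p) → xs ≡ ys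
!?-ext [] [] _ = refl
!?-ext [] (y ∷ ys) h with h 0
... | ()
!?-ext (x ∷ xs) [] h with h 0
... | ()
!?-ext (x ∷ xs) (y ∷ ys) h with h 0
... | refl = cong (x ∷_) (!?-ext xs ys (h ∘ suc))

!?-in-range : {A : Set} (d : A) → ∀ xs p → p < length xs → xs !? p ≡ just (at d xs p)
!?-in-range d (x ∷ xs) zero _ = refl
!?-in-range d (x ∷ xs) (suc p) (s≤s p<) = !?-in-range d xs p p<

!?-out-of-range : {A : Set} (xs : List A) → ∀ p → length xs ≤ p → xs !? p ≡ nothing
!?-out-of-range [] p _ = refl
!?-out-of-range (x ∷ xs) (suc p) (s≤s ≤p) = !?-out-of-range xs p ≤p

!?-map : {A B : Set} (f : A → B) → ∀ xs p → map f xs !? p ≡ Maybe.map f (xs !? p)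
!?-map f [] p = refl
!?-map f (x ∷ xs) zero = refl
!?-map f (x ∷ xs) (suc p) = !?-map f xs p

!?-zip : {A B : Set} (as : List A) (bs : List B) → ∀ p → zip as bs !? p ≡ Maybe.zip (as !? p) (bs !? p)
!?-zip [] bs p = refl
!?-zip (a ∷ as) [] zero = refl
!?-zip (a ∷ as) [] (suc p) with as !? p
... | just _ = refl
... | nothing = refl
!?-zip (a ∷ as) (b ∷ bs) zero = refl
!?-zip (a ∷ as) (b ∷ bs) (suc p) = !?-zip as bs p

!?-take : {A : Set} → ∀ m (xs : List A) p → p < m → take m xs !? p ≡ xs !? p
!?-take (suc m) [] p _ = refl
!?-take (suc m) (x ∷ xs) zero _ = refl
!?-take (suc m) (x ∷ xs) (suc p) (s≤s p<) = !?-take m xs p p<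

!?-take-out : {A : Set} → ∀ m (xs : List A) p → m ≤ p → take m xs !? p ≡ nothing
!?-take-out zero xs p _ = refl
!?-take-out (suc m) [] p _ = refl
!?-take-out (suc m) (x ∷ xs) (suc p) (s≤s ≤p) = !?-take-out m xs p ≤p

!?-drop : {A : Set} → ∀ m (xs : List A) q → drop m xs !? q ≡ xs !? (m + q)
!?-drop zero xs q = refl
!?-drop (suc m) [] q = refl
!?-drop (suc m) (x ∷ xs) q = !?-drop m xs q

!?-++ˡ : {A : Set} (xs ys : List A) → ∀ p → p < length xs → (xs ++ ys) !? p ≡ xs !? p
!?-++ˡ (x ∷ xs) ys zero _ = refl
!?-++ˡ (x ∷ xs) ys (suc p) (s≤s p<) = !?-++ˡ xs ys p p<

!?-++ʳ : {A : Set} (xs ys : List A) → ∀ q → (xs ++ ys) !? (length xs + q) ≡ ys !? q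
!?-++ʳ [] ys q = refl
!?-++ʳ (x ∷ xs) ys q = !?-++ʳ xs ys q

!?-reverse : {A : Set} (xs : List A) → ∀ p → p < length xs → reverse xs !? p ≡ xs !? (length xs ∸ suc p)
!?-reverse (x ∷ xs) p p< rewrite unfold-reverse x xs with <-cmp p (length xs)
... | tri< p<xs _ _ = begin
  (reverse xs ++ x ∷ []) !? p  ≡⟨ !?-++ˡ (reverse xs) (x ∷ []) p (subst (p <_) (sym (length-reverse xs)) p<xs) ⟩
  reverse xs !? p              ≡⟨ !?-reverse xs p p<xs ⟩
  xs !? (length xs ∸ suc p)    ≡⟨ cong ((x ∷ xs) !?_) (sym (+-∸-assoc 1 p<xs)) ⟩
  (x ∷ xs) !? (length (x ∷ xs) ∸ suc p) ∎
  where open ≡-Reasoning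
... | tri≈ _ refl _ = begin
  (reverse xs ++ x ∷ []) !? length xs           ≡⟨ cong ((reverse xs ++ x ∷ []) !?_) (sym (trans (+-identityʳ _) (length-reverse xs))) ⟩
  (reverse xs ++ x ∷ []) !? (length (reverse xs) + 0) ≡⟨ !?-++ʳ (reverse xs) (x ∷ []) 0 ⟩
  just x                                         ≡⟨ cong ((x ∷ xs) !?_) (sym (n∸n≡0 (length xs))) ⟩
  (x ∷ xs) !? (length xs ∸ length xs) ∎
  where open ≡-Reasoning
... | tri> _ _ p>xs = ⊥-elim (<⇒≱ p>xs (s≤s⁻¹ p<))

!?-upTo : ∀ m p → p < m → upTo m !? p ≡ just p
!?-upTo m p = go id m p
  where
  go : (f : ℕ → ℕ) → ∀ m p → p < m → applyUpTo f m !? p ≡ just (f p)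
  go f (suc m) zero _ = refl
  go f (suc m) (suc p) (s≤s p<) = go (f ∘ suc) m p p<

suc-suc/2 : ∀ x → suc (suc x) / 2 ≡ suc (x / 2)
suc-suc/2 x = m/n≡1+[m∸n]/n {suc (suc x)} {2} (s≤s (s≤s z≤n))

double/2 : ∀ m → (m + m) / 2 ≡ m
double/2 zero = refl
double/2 (suc m) = trans (cong (λ x → suc x / 2) (+-suc m m)) (trans (suc-suc/2 (m + m)) (cong suc (double/2 m)))

suc-double/2 : ∀ m → suc (m + m) / 2 ≡ m
suc-double/2 zero = refl
suc-double/2 (suc m) = trans (cong (λ x → suc (suc x) / 2) (+-suc m m)) (trans (suc-suc/2 (suc (m + m))) (cong suc (suc-double/2 m)))

parity : ∀ k → (isEven k ≡ true × k ≡ k / 2 + k / 2) ⊎ (isEven k ≡ false × k ≡ suc (k / 2 + k / 2))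
parity zero = inj₁ (refl , refl)
parity (suc zero) = inj₂ (refl , refl)
parity (suc (suc k)) rewrite suc-suc/2 k with parity k
... | inj₁ (ev , k≡) = inj₁ (ev , cong suc (trans (cong suc k≡) (sym (+-suc (k / 2) (k / 2)))))
... | inj₂ (od , k≡) = inj₂ (od , cong suc (trans (cong suc k≡) (cong suc (sym (+-suc (k / 2) (k / 2))))))

double<⇒<half : ∀ k b → suc (b + b) < k → b < k / 2
double<⇒<half k b lt with ≤-<-connex (k / 2) b
... | inj₂ b<h = b<h
... | inj₁ h≤b = ⊥-elim (<⇒≱ lt (≤-trans k≤ (s≤s (+-mono-≤ h≤b h≤b))))
  where
  k≤ : k ≤ suc (k / 2 + k / 2)
  k≤ with parity k
  ... | inj₁ (_ , e) = ≤-trans (≤-reflexive e) (n≤1+n _)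
  ... | inj₂ (_ , e) = ≤-reflexive e

<half⇒double< : ∀ k p → p < k / 2 → suc (p + p) < k
<half⇒double< k p lt = ≤-trans (s≤s (≤-reflexive (sym (+-suc p p)))) (≤-trans (+-mono-≤ lt lt) ≤k)
  where
  ≤k : k / 2 + k / 2 ≤ k
  ≤k with parity k
  ... | inj₁ (_ , e) = ≤-reflexive (sym e)
  ... | inj₂ (_ , e) = ≤-trans (n≤1+n _) (≤-reflexive (sym e))

outerPairs : {A : Set} → A → List A → ℕ → List (A × A)
outerPairs d xs m = map (λ p → at d xs p , at d xs (length xs ∸ suc p)) (upTo m)

pairUp-even : {A : Set} (d : A) (xs : List A) (m : ℕ) → length xs ≡ m + m →
              pairUp xs ≡ outerPairs d xs m
pairUp-even d xs m len = begin
  pairUp xs                               ≡⟨ cong (λ h → zip (take h xs) (reverse (drop h xs))) (trans (cong (_/ 2) len) (double/2 m)) ⟩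
  zip (take m xs) (reverse (drop m xs))   ≡⟨ !?-ext _ _ entry ⟩
  outerPairs d xs m ∎
  where
  open ≡-Reasoning
  len-drop : length (drop m xs) ≡ m
  len-drop = trans (length-drop m xs) (trans (cong (_∸ m) len) (m+n∸n≡m m m))
  mirrored : ∀ p → p < m → m + (m ∸ suc p) ≡ length xs ∸ suc p
  mirrored p p<m = trans (sym (+-∸-assoc m p<m)) (cong (_∸ suc p) (sym len))
  in-range : ∀ p → p < m + m → xs !? p ≡ just (at d xs p)
  in-range p p< = !?-in-range d xs p (subst (p <_) (sym len) p<)
  entry : ∀ p → zip (take m xs) (reverse (drop m xs)) !? p ≡ outerPairs d xs m !? p
  entry p with <-≤-connex p m
  ... | inj₁ p<m = begin
    zip (take m xs) (reverse (drop m xs)) !? p                   ≡⟨ !?-zip (take m xs) (reverse (drop m xs)) p ⟩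
    Maybe.zip (take m xs !? p) (reverse (drop m xs) !? p)        ≡⟨ cong₂ Maybe.zip (!?-take m xs p p<m)
                                                                      (!?-reverse (drop m xs) p (subst (p <_) (sym len-drop) p<m)) ⟩
    Maybe.zip (xs !? p) (drop m xs !? (length (drop m xs) ∸ suc p)) ≡⟨ cong (Maybe.zip (xs !? p))
                                                                      (trans (!?-drop m xs _) (cong (λ l → xs !? (m + (l ∸ suc p))) len-drop)) ⟩
    Maybe.zip (xs !? p) (xs !? (m + (m ∸ suc p)))                 ≡⟨ cong₂ Maybe.zip (in-range p (≤-trans p<m (m≤m+n m m)))
                                                                      (in-range _ (+-monoʳ-< m (∸-monoʳ-< {m} {suc p} {0} (s≤s z≤n) p<m))) ⟩
    just (at d xs p , at d xs (m + (m ∸ suc p)))                 ≡⟨ cong (λ j → just (at d xs p , at d xs j)) (mirrored p p<m) ⟩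
    just (at d xs p , at d xs (length xs ∸ suc p))               ≡⟨ cong (Maybe.map _) (sym (!?-upTo m p p<m)) ⟩
    Maybe.map _ (upTo m !? p)                                    ≡⟨ sym (!?-map _ (upTo m) p) ⟩
    outerPairs d xs m !? p ∎
  ... | inj₂ m≤p = trans (!?-zip (take m xs) (reverse (drop m xs)) p)
                   (trans (cong (λ o → Maybe.zip o (reverse (drop m xs) !? p)) (!?-take-out m xs p m≤p))
                   (sym (trans (!?-map _ (upTo m) p) (cong (Maybe.map _) (!?-out-of-range (upTo m) p (subst (_≤ p) (sym (length-upTo m)) m≤p))))))

pairUp-odd : {A : Set} (d : A) (xs : List A) (m : ℕ) → length xs ≡ suc (m + m) →
             pairUp (dropMiddle xs) ≡ outerPairs d xs m
pairUp-odd d xs m len = begin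
  pairUp (dropMiddle xs)       ≡⟨ cong pairUp dropMiddle≡ ⟩
  pairUp ys                    ≡⟨ pairUp-even d ys m len-ys ⟩
  outerPairs d ys m            ≡⟨ map-cong-local (applyUpTo⁺₁ id m same-pair) ⟩
  outerPairs d xs m ∎
  where
  open ≡-Reasoning
  ys : List _
  ys = take m xs ++ drop (suc m) xs
  dropMiddle≡ : dropMiddle xs ≡ ys
  dropMiddle≡ = cong (λ h → take h xs ++ drop (suc h) xs) (trans (cong (_/ 2) len) (suc-double/2 m))
  len-take : length (take m xs) ≡ m
  len-take = trans (length-take m xs) (m≤n⇒m⊓n≡m (≤-trans (m≤m+n m m) (≤-trans (n≤1+n _) (≤-reflexive (sym len)))))
  len-drop : length (drop (suc m) xs) ≡ m
  len-drop = trans (length-drop (suc m) xs) (trans (cong (_∸ suc m) len) (m+n∸m≡n (suc m) m))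
  len-ys : length ys ≡ m + m
  len-ys = trans (length-++ (take m xs)) (cong₂ _+_ len-take len-drop)
  low : ∀ p → p < m → ys !? p ≡ xs !? p
  low p p<m = trans (!?-++ˡ (take m xs) (drop (suc m) xs) p (subst (p <_) (sym len-take) p<m)) (!?-take m xs p p<m)
  high : ∀ p → p < m → ys !? (length ys ∸ suc p) ≡ xs !? (length xs ∸ suc p)
  high p p<m = begin
    ys !? (length ys ∸ suc p)                 ≡⟨ cong (ys !?_) (trans (cong (_∸ suc p) len-ys) (+-∸-assoc m p<m)) ⟩
    ys !? (m + (m ∸ suc p))                   ≡⟨ cong (λ l → ys !? (l + (m ∸ suc p))) (sym len-take) ⟩
    ys !? (length (take m xs) + (m ∸ suc p))  ≡⟨ !?-++ʳ (take m xs) (drop (suc m) xs) (m ∸ suc p) ⟩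
    drop (suc m) xs !? (m ∸ suc p)            ≡⟨ !?-drop (suc m) xs (m ∸ suc p) ⟩
    xs !? (suc m + (m ∸ suc p))               ≡⟨ cong (xs !?_) (trans (sym (+-∸-assoc (suc m) p<m)) (cong (_∸ suc p) (sym len))) ⟩
    xs !? (length xs ∸ suc p) ∎
  same-pair : ∀ {p} → p < m → (at d ys p , at d ys (length ys ∸ suc p)) ≡ (at d xs p , at d xs (length xs ∸ suc p))
  same-pair {p} p<m = cong₂ _,_ (cong (Maybe.fromMaybe d) (low p p<m)) (cong (Maybe.fromMaybe d) (high p p<m))

countBelow : {n : ℕ} → (Fin n → Bool) → ℕ → ℕ
countBelow {n} q m = count (λ r → q r ∧ (toℕ r <ᵇ m)) (allF n)

allFin-suc : ∀ n → allFin (suc n) ≡ Fin.zero ∷ map Fin.suc (allFin n)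
allFin-suc n = cong (Fin.zero ∷_) (sym (map-tabulate id Fin.suc))

filter-position : ∀ n (q : Fin n → Bool) t → q t ≡ true →
                  filterᵇ q (allF n) !? countBelow q (toℕ t) ≡ just t
filter-position (suc n) q t qt =
  subst (λ L → filterᵇ q L !? count (λ r → q r ∧ (toℕ r <ᵇ toℕ t)) L ≡ just t) (sym (allFin-suc n)) (split t qt)
  where
  rest : List (Fin (suc n))
  rest = map Fin.suc (allFin n)
  -- positions 1 … n, where the claim is the induction hypothesis for q ∘ suc
  shifted : ∀ t → q (Fin.suc t) ≡ true →
            filterᵇ q rest !? count (λ r → q r ∧ (toℕ r <ᵇ suc (toℕ t))) rest ≡ just (Fin.suc t)
  shifted t qt = begin
    filterᵇ q rest !? count (λ r → q r ∧ (toℕ r <ᵇ suc (toℕ t))) rest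
      ≡⟨ cong₂ _!?_ (filterᵇ-map Fin.suc q (allFin n)) (count-map Fin.suc (λ r → q r ∧ (toℕ r <ᵇ suc (toℕ t))) (allFin n)) ⟩
    map Fin.suc (filterᵇ (q ∘ Fin.suc) (allF n)) !? countBelow (q ∘ Fin.suc) (toℕ t)
      ≡⟨ !?-map Fin.suc (filterᵇ (q ∘ Fin.suc) (allF n)) _ ⟩
    Maybe.map Fin.suc (filterᵇ (q ∘ Fin.suc) (allF n) !? countBelow (q ∘ Fin.suc) (toℕ t))
      ≡⟨ cong (Maybe.map Fin.suc) (filter-position n (q ∘ Fin.suc) t qt) ⟩
    just (Fin.suc t) ∎
    where open ≡-Reasoning
  split : ∀ t → q t ≡ true →
          filterᵇ q (Fin.zero ∷ rest) !? count (λ r → q r ∧ (toℕ r <ᵇ toℕ t)) (Fin.zero ∷ rest) ≡ just t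
  split Fin.zero qt rewrite qt =
    cong ((Fin.zero ∷ filterᵇ q rest) !?_) (count-none {p = λ r → q r ∧ false} rest (λ r _ → ∧-zeroʳ (q r)))
  split (Fin.suc t) qt with q Fin.zero
  ... | true  = shifted t qt
  ... | false = shifted t qt

module Ranks {n : ℕ} (q : Fin n → Bool) where

  atPosition : ℕ → Fin n → Bool
  atPosition m r = q r ∧ (toℕ r ≡ᵇ m)

  atPosition-≤1 : ∀ m → count (atPosition m) (allF n) ≤ 1
  atPosition-≤1 m with count (atPosition m) (allF n) in c
  ... | zero = z≤n
  ... | suc _ with count-pos⇒witness (allF n) (subst (0 <_) (sym c) (s≤s z≤n))
  ...   | t , _ , qt = ≤-reflexive (trans (sym c)
          (count-single (allF n) (allFin⁺ n) (∈-allFin t) qt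
             (λ r qr → toℕ-injective (trans (≡ᵇ-sound (∧-elimʳ {q r} qr)) (sym (≡ᵇ-sound (∧-elimʳ {q t} qt)))))))

  countBelow-suc : ∀ m → countBelow q (suc m) ≡ countBelow q m + count (atPosition m) (allF n)
  countBelow-suc m = trans (count-split (λ r → q r ∧ (toℕ r <ᵇ suc m)) (λ r → toℕ r <ᵇ m) (allF n))
    (cong₂ _+_ (count-ext earlier earlier⁻¹ (allF n)) (count-ext exact exact⁻¹ (allF n)))
    where
    earlier : ∀ r → (q r ∧ (toℕ r <ᵇ suc m)) ∧ (toℕ r <ᵇ m) ≡ true → q r ∧ (toℕ r <ᵇ m) ≡ true
    earlier r e = ∧-intro (∧-elimˡ {q r} (∧-elimˡ {q r ∧ (toℕ r <ᵇ suc m)} e)) (∧-elimʳ {q r ∧ (toℕ r <ᵇ suc m)} e)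
    earlier⁻¹ : ∀ r → q r ∧ (toℕ r <ᵇ m) ≡ true → (q r ∧ (toℕ r <ᵇ suc m)) ∧ (toℕ r <ᵇ m) ≡ true
    earlier⁻¹ r e = ∧-intro (∧-intro (∧-elimˡ {q r} e) (<ᵇ-complete (m<n⇒m<1+n (<ᵇ-sound {toℕ r} {m} (∧-elimʳ {q r} e))))) (∧-elimʳ {q r} e)
    exact : ∀ r → (q r ∧ (toℕ r <ᵇ suc m)) ∧ not (toℕ r <ᵇ m) ≡ true → atPosition m r ≡ true
    exact r e = ∧-intro (∧-elimˡ {q r} (∧-elimˡ {q r ∧ (toℕ r <ᵇ suc m)} e))
      (≡ᵇ-complete (≤-antisym (s≤s⁻¹ (<ᵇ-sound {toℕ r} {suc m} (∧-elimʳ {q r} (∧-elimˡ {q r ∧ (toℕ r <ᵇ suc m)} e))))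
                              (≮⇒≥ (false⇒≢true (not-elim (∧-elimʳ {q r ∧ (toℕ r <ᵇ suc m)} e)) ∘ <ᵇ-complete {toℕ r} {m}))))
    exact⁻¹ : ∀ r → atPosition m r ≡ true → (q r ∧ (toℕ r <ᵇ suc m)) ∧ not (toℕ r <ᵇ m) ≡ true
    exact⁻¹ r e with ≡ᵇ-sound {toℕ r} {m} (∧-elimʳ {q r} e)
    ... | refl = ∧-intro (∧-intro (∧-elimˡ {q r} e) (<ᵇ-complete {toℕ r} {suc (toℕ r)} ≤-refl)) (not-intro (≢true⇒false (<-irrefl refl ∘ <ᵇ-sound {toℕ r} {toℕ r})))

  countBelow-all : countBelow q n ≡ count q (allF n)
  countBelow-all = count-ext (λ r e → ∧-elimˡ {q r} e) (λ r e → ∧-intro e (<ᵇ-complete (toℕ<n r))) (allF n)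

  -- every value below countBelow q m is attained as a rank (discrete
  -- intermediate value theorem: countBelow grows by steps of at most one)
  countBelow-onto : ∀ m p → p < countBelow q m → ∃[ t ] (q t ≡ true × countBelow q (toℕ t) ≡ p)
  countBelow-onto zero p p< = ⊥-elim (n≮0 (subst (p <_) (count-none (allF n) (λ r _ → ∧-zeroʳ (q r))) p<))
  countBelow-onto (suc m) p p< with <-≤-connex p (countBelow q m)
  ... | inj₁ p<c = countBelow-onto m p p<c
  ... | inj₂ c≤p with count-pos⇒witness (allF n) jump
    where
    jump : 0 < count (atPosition m) (allF n)
    jump with count (atPosition m) (allF n) in c
    ... | zero = ⊥-elim (<⇒≱ p< (subst (_≤ p) (sym (trans (countBelow-suc m) (trans (cong (countBelow q m +_) c) (+-identityʳ _)))) c≤p))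
    ... | suc _ = s≤s z≤n
  ... | t , _ , qt with ≡ᵇ-sound {toℕ t} {m} (∧-elimʳ {q t} qt)
  ... | refl = t , ∧-elimˡ {q t} qt , ≤-antisym c≤p (s≤s⁻¹ (≤-trans p< (≤-trans (≤-reflexive (countBelow-suc m))
                 (≤-trans (+-monoʳ-≤ (countBelow q m) (atPosition-≤1 m)) (≤-reflexive (+-comm (countBelow q m) 1))))))

  rank-onto : ∀ p → p < count q (allF n) → ∃[ t ] (q t ≡ true × countBelow q (toℕ t) ≡ p)
  rank-onto p p< = countBelow-onto n p (subst (p <_) (sym countBelow-all) p<)

∈-filter-allF⁻ : ∀ {n} {q : Fin n → Bool} {x} → x ∈ filterᵇ q (allF n) → q x ≡ true
∈-filter-allF⁻ {n} {q} x∈ = T⇒≡true (proj₂ (∈-filter⁻ (T? ∘ q) {xs = allF n} x∈))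

∈-filter-allF⁺ : ∀ {n} {q : Fin n → Bool} {x} → q x ≡ true → x ∈ filterᵇ q (allF n)
∈-filter-allF⁺ {n} {q} {x} e = ∈-filter⁺ (T? ∘ q) (∈-allFin x) (≡true⇒T e)

unique-filter-allF : ∀ {n} (q : Fin n → Bool) → Unique (filterᵇ q (allF n))
unique-filter-allF {n} q = filter⁺ (T? ∘ q) (allFin⁺ n)

count-bijection : ∀ {n} (p q : Fin n → Bool) (h : Fin n → Fin n) →
  (∀ {x} → p x ≡ true → q (h x) ≡ true) →
  (∀ {x x'} → p x ≡ true → p x' ≡ true → h x ≡ h x' → x ≡ x') →
  (∀ {y} → q y ≡ true → ∃[ x ] (p x ≡ true × h x ≡ y)) →
  count p (allF n) ≡ count q (allF n)
count-bijection {n} p q h into inj onto = begin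
  length (filterᵇ p (allF n))                  ≡⟨ sym (length-map (λ _ → tt) (filterᵇ p (allF n))) ⟩
  length (map (λ _ → tt) (filterᵇ p (allF n))) ≡⟨ ↭-length (↭-from-bijection (λ _ → tt) (λ _ → tt) h _ _
                                                    (unique-filter-allF p) (unique-filter-allF q)
                                                    (∈-filter-allF⁺ ∘ into ∘ ∈-filter-allF⁻)
                                                    (λ x∈ x'∈ → inj (∈-filter-allF⁻ x∈) (∈-filter-allF⁻ x'∈))
                                                    onto' (λ _ → refl)) ⟩
  length (map (λ _ → tt) (filterᵇ q (allF n))) ≡⟨ length-map (λ _ → tt) (filterᵇ q (allF n)) ⟩
  length (filterᵇ q (allF n)) ∎
  where
  open ≡-Reasoning
  onto' : ∀ {y} → y ∈ filterᵇ q (allF n) → ∃[ x ] (x ∈ filterᵇ p (allF n) × h x ≡ y)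
  onto' y∈ with onto (∈-filter-allF⁻ y∈)
  ... | x , px , hx = x , ∈-filter-allF⁺ px , hx

module BlockExtremes {n : ℕ} (σ : PRel n) where

  isMax-elim : ∀ {r} → isMaxB σ r ≡ true → ∀ j → σ r j ≡ true → toℕ j ≤ toℕ r
  isMax-elim {r} e j rj with ∨-elim (all-elim {p = λ j → not (σ r j) ∨ (toℕ j ≤ᵇ toℕ r)} (allF n) (∈-allFin j) e)
  ... | inj₁ r≁j = ⊥-elim (true≢false (trans (sym rj) (not-elim r≁j)))
  ... | inj₂ j≤r = ≤ᵇ-sound j≤r

  isMax-intro : ∀ {r} → (∀ j → σ r j ≡ true → toℕ j ≤ toℕ r) → isMaxB σ r ≡ true
  isMax-intro {r} h = all-intro (allF n) λ j _ → test j
    where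
    test : ∀ j → not (σ r j) ∨ (toℕ j ≤ᵇ toℕ r) ≡ true
    test j with σ r j in rj
    ... | true = ≤ᵇ-complete (h j rj)
    ... | false = refl

  isMin-elim : ∀ {r} → isMinB σ r ≡ true → ∀ j → σ r j ≡ true → toℕ r ≤ toℕ j
  isMin-elim {r} e j rj with ∨-elim (all-elim {p = λ j → not (σ r j) ∨ (toℕ r ≤ᵇ toℕ j)} (allF n) (∈-allFin j) e)
  ... | inj₁ r≁j = ⊥-elim (true≢false (trans (sym rj) (not-elim r≁j)))
  ... | inj₂ r≤j = ≤ᵇ-sound r≤j

  isMin-intro : ∀ {r} → (∀ j → σ r j ≡ true → toℕ r ≤ toℕ j) → isMinB σ r ≡ true
  isMin-intro {r} h = all-intro (allF n) λ j _ → test j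
    where
    test : ∀ j → not (σ r j) ∨ (toℕ r ≤ᵇ toℕ j) ≡ true
    test j with σ r j in rj
    ... | true = ≤ᵇ-complete (h j rj)
    ... | false = refl

module Noncrossing {n : ℕ} (σ : PRel n) (NCσ : IsNC n σ) where
  open BlockExtremes σ public

  σ-refl : ∀ i → σ i i ≡ true
  σ-refl = proj₁ (proj₁ NCσ)

  σ-sym : ∀ {i j} → σ i j ≡ true → σ j i ≡ true
  σ-sym {i} {j} = proj₁ (proj₂ (proj₁ NCσ)) i j

  σ-trans : ∀ {i j k} → σ i j ≡ true → σ j k ≡ true → σ i k ≡ true
  σ-trans {i} {j} {k} = proj₂ (proj₂ (proj₁ NCσ)) i j k

  no-crossing-edges : ∀ a b c d → Edge σ a b → Edge σ c d →
                      toℕ a < toℕ c → toℕ c < toℕ b → toℕ b < toℕ d → ⊥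
  no-crossing-edges = proj₂ NCσ

  apart : ∀ {x y z} → σ x y ≡ false → σ x z ≡ true → toℕ z ≢ toℕ y
  apart {x} f t e = true≢false (trans (sym (subst (λ w → σ x w ≡ true) (toℕ-injective e) t)) f)

  leave : ∀ {i j j'} → σ i j ≡ false → σ j j' ≡ true → σ i j' ≡ false
  leave i≁j jj' = ≢true⇒false λ ij' → true≢false (trans (sym (σ-trans ij' (σ-sym jj'))) i≁j)

  leave-sym : ∀ {i j} → σ i j ≡ false → σ j i ≡ false
  leave-sym i≁j = ≢true⇒false λ ji → true≢false (trans (sym (σ-sym ji)) i≁j)

  record Straddle (c d : Fin n) (t : ℕ) : Set where
    field
      e f : Fin n
      edge : Edge σ e f
      c~e : σ c e ≡ true
      c≤e : toℕ c ≤ toℕ e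
      e≤t : toℕ e ≤ t
      t<f : t < toℕ f
      f≤d : toℕ f ≤ toℕ d

  straddle : ∀ {c d} t → σ c d ≡ true → toℕ c ≤ t → t < toℕ d → Straddle c d t
  straddle {c} {d} t cd c≤t t<d
    with latest (λ j → σ c j ∧ (toℕ j ≤ᵇ t)) (allF n) (∈-allFin c) (∧-intro (σ-refl c) (≤ᵇ-complete c≤t))
       | earliest (λ j → σ c j ∧ (t <ᵇ toℕ j)) (allF n) (∈-allFin d) (∧-intro cd (<ᵇ-complete t<d))
  ... | e , _ , pe , e-last | f , _ , pf , f-first = record
    { e = e ; f = f
    ; edge = ≤-<-trans e≤t t<f , σ-trans (σ-sym (∧-elimˡ pe)) (∧-elimˡ pf) , gap
    ; c~e = ∧-elimˡ pe ; c≤e = e-last c (∈-allFin c) (∧-intro (σ-refl c) (≤ᵇ-complete c≤t)) ; e≤t = e≤t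
    ; t<f = t<f ; f≤d = f-first d (∈-allFin d) (∧-intro cd (<ᵇ-complete t<d)) }
    where
    e≤t : toℕ e ≤ t
    e≤t = ≤ᵇ-sound (∧-elimʳ {σ c e} pe)
    t<f : t < toℕ f
    t<f = <ᵇ-sound (∧-elimʳ {σ c f} pf)
    gap : ∀ k → toℕ e < toℕ k → toℕ k < toℕ f → σ e k ≡ false
    gap k e<k k<f = ≢true⇒false λ ek → side (σ-trans (∧-elimˡ pe) ek)
      where
      side : σ c k ≡ true → ⊥
      side ck with ≤-<-connex (toℕ k) t
      ... | inj₁ k≤t = <⇒≱ e<k (e-last k (∈-allFin k) (∧-intro ck (≤ᵇ-complete k≤t)))
      ... | inj₂ t<k = <⇒≱ k<f (f-first k (∈-allFin k) (∧-intro ck (<ᵇ-complete t<k)))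

  noncrossing-4 : ∀ {a b c d} → σ a c ≡ true → σ b d ≡ true →
                  toℕ a < toℕ b → toℕ b < toℕ c → toℕ c < toℕ d → σ a b ≡ true
  noncrossing-4 {a} {b} {c} {d} ac bd a<b b<c c<d with σ a b in ab
  ... | true = refl
  ... | false = ⊥-elim (no-crossing-edges S.e S.f U.e U.f S.edge U.edge (<-≤-trans e<b U.c≤e) g<f U.t<f)
    where
    S = straddle {a} {c} (toℕ b) ac (<⇒≤ a<b) b<c
    module S = Straddle S
    e<b : toℕ S.e < toℕ b
    e<b = ≤∧≢⇒< S.e≤t (apart ab S.c~e)
    U = straddle {b} {d} (toℕ S.f) bd (<⇒≤ S.t<f) (≤-<-trans S.f≤d c<d)
    module U = Straddle U
    a~f : σ a S.f ≡ true
    a~f = σ-trans S.c~e (proj₁ (proj₂ S.edge))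
    g<f : toℕ U.e < toℕ S.f
    g<f = ≤∧≢⇒< U.e≤t (apart (leave ab U.c~e) a~f ∘ sym)

  nested-inside-edge : ∀ {a b c} → σ a c ≡ true → σ a b ≡ false → toℕ a < toℕ b → toℕ b < toℕ c →
    ∃[ e ] ∃[ f ] (Edge σ e f × (∀ b' → σ b b' ≡ true → toℕ e < toℕ b' × toℕ b' < toℕ f))
  nested-inside-edge {a} {b} {c} ac ab a<b b<c = S.e , S.f , S.edge , λ b' bb' → above b' bb' , under b' bb'
    where
    S = straddle {a} {c} (toℕ b) ac (<⇒≤ a<b) b<c
    module S = Straddle S
    e<b : toℕ S.e < toℕ b
    e<b = ≤∧≢⇒< S.e≤t (apart ab S.c~e)
    a~f : σ a S.f ≡ true
    a~f = σ-trans S.c~e (proj₁ (proj₂ S.edge))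
    outside : ∀ {w} → σ b w ≡ true → σ a w ≡ false
    outside = leave ab
    under : ∀ b' → σ b b' ≡ true → toℕ b' < toℕ S.f
    under b' bb' with <-cmp (toℕ b') (toℕ S.f)
    ... | tri< b'<f _ _ = b'<f
    ... | tri≈ _ b'≡f _ = ⊥-elim (apart (outside bb') a~f (sym b'≡f))
    ... | tri> _ _ f<b' = ⊥-elim (no-crossing-edges S.e S.f U.e U.f S.edge U.edge (<-≤-trans e<b U.c≤e) g<f U.t<f)
      where
      U = straddle {b} {b'} (toℕ S.f) bb' (<⇒≤ S.t<f) f<b'
      module U = Straddle U
      g<f : toℕ U.e < toℕ S.f
      g<f = ≤∧≢⇒< U.e≤t (apart (outside U.c~e) a~f ∘ sym)
    above : ∀ b' → σ b b' ≡ true → toℕ S.e < toℕ b'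
    above b' bb' with <-cmp (toℕ b') (toℕ S.e)
    ... | tri≈ _ b'≡e _ = ⊥-elim (apart (outside bb') S.c~e (sym b'≡e))
    ... | tri> _ _ e<b' = e<b'
    ... | tri< b'<e _ _ = ⊥-elim (no-crossing-edges U.e U.f S.e S.f U.edge S.edge g<e U.t<f (≤-<-trans U.f≤d S.t<f))
      where
      U = straddle {b'} {b} (toℕ S.e) (σ-sym bb') (<⇒≤ b'<e) e<b
      module U = Straddle U
      g<e : toℕ U.e < toℕ S.e
      g<e = ≤∧≢⇒< U.e≤t (apart (outside (σ-trans bb' U.c~e)) S.c~e ∘ sym)

  block-max : ∀ i → ∃[ m ] (σ i m ≡ true × isMaxB σ m ≡ true)
  block-max i with latest (σ i) (allF n) (∈-allFin i) (σ-refl i)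
  ... | m , _ , im , m-last = m , im , isMax-intro λ j mj → m-last j (∈-allFin j) (σ-trans im mj)

  block-min : ∀ i → ∃[ m ] (σ i m ≡ true × isMinB σ m ≡ true)
  block-min i with earliest (σ i) (allF n) (∈-allFin i) (σ-refl i)
  ... | m , _ , im , m-first = m , im , isMin-intro λ j mj → m-first j (∈-allFin j) (σ-trans im mj)

  max-unique : ∀ {r r'} → σ r r' ≡ true → isMaxB σ r ≡ true → isMaxB σ r' ≡ true → r ≡ r'
  max-unique rr' m m' = toℕ-injective (≤-antisym (isMax-elim m' _ (σ-sym rr')) (isMax-elim m _ rr'))

  min-unique : ∀ {r r'} → σ r r' ≡ true → isMinB σ r ≡ true → isMinB σ r' ≡ true → r ≡ r'
  min-unique rr' m m' = toℕ-injective (≤-antisym (isMin-elim m _ rr') (isMin-elim m' _ (σ-sym rr')))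

module XBlocks {n : ℕ} (σ : PRel n) (X : Fin n → Bool) (H : IsNCNN n (σ , X)) where
  open Noncrossing σ (proj₁ H) public

  X-blockwise : ∀ {i j} → σ i j ≡ true → X i ≡ X j
  X-blockwise {i} {j} = proj₁ (proj₂ H) i j

  X-nonnested : ∀ i → X i ≡ true → NonNested σ i
  X-nonnested = proj₂ (proj₂ H)

  -- Distinct X-blocks do not interleave: if i < j lie in different
  -- X-blocks, every element of the block of i precedes every element of
  -- the block of j (otherwise one of the two blocks would be nested).
  X-blocks-ordered : ∀ {i j i' j'} → X i ≡ true → X j ≡ true → σ i j ≡ false → toℕ i < toℕ j →
                     σ i i' ≡ true → σ j j' ≡ true → toℕ i' < toℕ j'
  X-blocks-ordered {i} {j} {i'} {j'} xi xj i≁j i<j ii' jj' with <-cmp (toℕ i') (toℕ j')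
  ... | tri< i'<j' _ _ = i'<j'
  ... | tri≈ _ i'≡j' _ = ⊥-elim (apart (leave i≁j jj') ii' i'≡j')
  ... | tri> _ _ j'<i' with <-cmp (toℕ i) (toℕ j')
  ...   | tri≈ _ i≡j' _ = ⊥-elim (apart (leave i≁j jj') (σ-refl i) i≡j')
  ...   | tri< i<j' _ _ with nested-inside-edge ii' (leave i≁j jj') i<j' j'<i'
  ...     | e , f , edge , inside = ⊥-elim (X-nonnested j xj e f edge (λ b jb → inside b (σ-trans (σ-sym jj') jb)))
  X-blocks-ordered {i} {j} {i'} {j'} xi xj i≁j i<j ii' jj' | tri> _ _ j'<i' | tri> _ _ j'<i
    with nested-inside-edge (σ-sym jj') (leave-sym (leave i≁j jj')) j'<i i<j
  ... | e , f , edge , inside = ⊥-elim (X-nonnested i xi e f edge inside)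

  -- r is the maximum of an X-block; the X-blocks are represented by these
  isXMax : Fin n → Bool
  isXMax r = X r ∧ isMaxB σ r

  k : ℕ
  k = count isXMax (allF n)

  -- index i = p  when i lies in A_{p+1}: the number of X-blocks ending before i
  index : Fin n → ℕ
  index i = countBelow isXMax (toℕ i)

  X-block-max : ∀ i → X i ≡ true → ∃[ m ] (σ i m ≡ true × isXMax m ≡ true)
  X-block-max i xi with block-max i
  ... | m , im , max = m , im , ∧-intro (trans (sym (X-blockwise im)) xi) max

  X-max-before-block : ∀ {i i' r} → X i ≡ true → σ i i' ≡ true → isXMax r ≡ true →
                       toℕ r < toℕ i → toℕ r < toℕ i'
  X-max-before-block {i} {i'} {r} xi ii' xr r<i with <-cmp (toℕ r) (toℕ i')
  ... | tri< r<i' _ _ = r<i'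
  ... | tri≈ _ r≡i' _ = ⊥-elim (<⇒≱ r<i (isMax-elim (∧-elimʳ {X r} xr) i (subst (λ w → σ w i ≡ true) (sym (toℕ-injective r≡i')) (σ-sym ii'))))
  ... | tri> _ _ i'<r = ⊥-elim (<⇒≱ r<i (<⇒≤ (X-blocks-ordered (trans (sym (X-blockwise ii')) xi) (∧-elimˡ xr)
                                                 (leave-sym (leave r≁i ii')) i'<r (σ-sym ii') (σ-refl r))))
    where
    r≁i : σ r i ≡ false
    r≁i = ≢true⇒false λ ri → <⇒≱ r<i (isMax-elim (∧-elimʳ {X r} xr) i ri)

  index-blockwise : ∀ {i i'} → X i ≡ true → σ i i' ≡ true → index i ≡ index i'
  index-blockwise {i} {i'} xi ii' = count-ext
    (λ r e → ∧-intro (∧-elimˡ e) (<ᵇ-complete (X-max-before-block xi ii' (∧-elimˡ e) (<ᵇ-sound (∧-elimʳ {isXMax r} e)))))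
    (λ r e → ∧-intro (∧-elimˡ e) (<ᵇ-complete (X-max-before-block (trans (sym (X-blockwise ii')) xi) (σ-sym ii')
                                                  (∧-elimˡ e) (<ᵇ-sound (∧-elimʳ {isXMax r} e)))))
    (allF n)

  index-strict : ∀ {i j} → X i ≡ true → X j ≡ true → σ i j ≡ false → toℕ i < toℕ j → index i < index j
  index-strict {i} {j} xi xj i≁j i<j with X-block-max i xi
  ... | m , im , xm = count-strict (λ r e → ∧-intro (∧-elimˡ e) (<ᵇ-complete (<-trans (<ᵇ-sound (∧-elimʳ {isXMax r} e)) i<j)))
      (allF n) (∈-allFin m) (∧-intro xm (<ᵇ-complete (X-blocks-ordered xi xj i≁j i<j im (σ-refl j))))
      (≢true⇒false λ e → <⇒≱ (<ᵇ-sound (∧-elimʳ {isXMax m} e)) (isMax-elim (∧-elimʳ {X m} xm) i (σ-sym im)))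

  index-injective : ∀ {i j} → X i ≡ true → X j ≡ true → index i ≡ index j → σ i j ≡ true
  index-injective {i} {j} xi xj e with σ i j in ij
  ... | true = refl
  ... | false with <-cmp (toℕ i) (toℕ j)
  ...   | tri< i<j _ _ = ⊥-elim (<-irrefl e (index-strict xi xj ij i<j))
  ...   | tri≈ _ i≡j _ = ⊥-elim (apart ij (σ-refl i) i≡j)
  ...   | tri> _ _ j<i = ⊥-elim (<-irrefl (sym e) (index-strict xj xi (leave-sym ij) j<i))

  index<k : ∀ {i} → X i ≡ true → index i < k
  index<k {i} xi with X-block-max i xi
  ... | m , im , xm = count-strict (λ r e → ∧-elimˡ e) (allF n) (∈-allFin m) xm
      (≢true⇒false λ e → <⇒≱ (<ᵇ-sound (∧-elimʳ {isXMax m} e)) (isMax-elim (∧-elimʳ {X m} xm) i (σ-sym im)))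

  index-onto : ∀ p → p < k → ∃[ t ] (isXMax t ≡ true × index t ≡ p)
  index-onto = Ranks.rank-onto isXMax

  -- The pairing of X-blocks: A_p is paired with A_{k+1-p}.
  Paired : Fin n → Fin n → Bool
  Paired i j = X i ∧ X j ∧ (suc (index i + index j) ≡ᵇ k)

  Paired-elim : ∀ {i j} → Paired i j ≡ true → X i ≡ true × X j ≡ true × suc (index i + index j) ≡ k
  Paired-elim {i} {j} e = ∧-elimˡ e , ∧-elimˡ (∧-elimʳ {X i} e) , ≡ᵇ-sound (∧-elimʳ {X j} (∧-elimʳ {X i} e))

  Paired-intro : ∀ {i j} → X i ≡ true → X j ≡ true → suc (index i + index j) ≡ k → Paired i j ≡ true
  Paired-intro xi xj e = ∧-intro xi (∧-intro xj (≡ᵇ-complete e))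

  Paired-sym : ∀ i j → Paired i j ≡ Paired j i
  Paired-sym i j = bool-ext (swap i j) (swap j i)
    where
    swap : ∀ i j → Paired i j ≡ true → Paired j i ≡ true
    swap i j e with Paired-elim {i} {j} e
    ... | xi , xj , s = Paired-intro xj xi (trans (cong suc (+-comm (index j) (index i))) s)

  Paired-left : ∀ {i i' j} → σ i i' ≡ true → Paired i j ≡ true → Paired i' j ≡ true
  Paired-left {i} {i'} {j} ii' e with Paired-elim {i} {j} e
  ... | xi , xj , s = Paired-intro (trans (sym (X-blockwise ii')) xi) xj
                        (trans (cong (λ z → suc (z + index j)) (sym (index-blockwise xi ii'))) s)

  Paired-right : ∀ {i j j'} → σ j j' ≡ true → Paired i j ≡ true → Paired i j' ≡ true
  Paired-right {i} {j} {j'} jj' e =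
    trans (Paired-sym i j') (Paired-left jj' (trans (Paired-sym j i) e))

  Paired-unique : ∀ {i j j'} → Paired i j ≡ true → Paired i j' ≡ true → σ j j' ≡ true
  Paired-unique {i} {j} {j'} e e' with Paired-elim {i} {j} e | Paired-elim {i} {j'} e'
  ... | _ , xj , s | _ , xj' , s' = index-injective xj xj' (+-cancelˡ-≡ (index i) _ _ (suc-injective (trans s (sym s'))))

  partner : ∀ {i} → X i ≡ true → ∃[ t ] (isXMax t ≡ true × Paired i t ≡ true)
  partner {i} xi with index-onto (k ∸ suc (index i)) (∸-monoʳ-< {k} {suc (index i)} {0} (s≤s z≤n) (index<k xi))
  ... | t , xt , it = t , xt , Paired-intro xi (∧-elimˡ xt) (trans (cong (λ z → suc (index i + z)) it) (m+[n∸m]≡n (index<k xi)))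

  self-paired-unique : ∀ {i j} → Paired i i ≡ true → Paired j j ≡ true → σ i j ≡ true
  self-paired-unique {i} {j} ii jj with Paired-elim {i} {i} ii | Paired-elim {j} {j} jj
  ... | xi , _ , s | xj , _ , s' = index-injective xi xj (double-injective (suc-injective (trans s (sym s'))))
    where
    double-injective : ∀ {a b} → a + a ≡ b + b → a ≡ b
    double-injective {a} {b} e with <-cmp a b
    ... | tri< a<b _ _ = ⊥-elim (<-irrefl e (+-mono-< a<b a<b))
    ... | tri≈ _ a≡b _ = a≡b
    ... | tri> _ _ b<a = ⊥-elim (<-irrefl (sym e) (+-mono-< b<a b<a))

pos<neg : ∀ {n} (a b : Fin n) → rank (pos a) < rank (neg b)
pos<neg {n} a b = <-≤-trans (toℕ<n a) (m≤m+n n (toℕ b))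

neg⊀pos : ∀ {n} (a b : Fin n) → rank (neg a) < rank (pos b) → ⊥
neg⊀pos a b lt = <-asym lt (pos<neg b a)

module TypeB {n : ℕ} (π : BRel n) (HB : IsNCB n π) where

  π-refl : ∀ x → π x x ≡ true
  π-refl = proj₁ (proj₁ HB)

  π-sym : ∀ {x y} → π x y ≡ true → π y x ≡ true
  π-sym {x} {y} = proj₁ (proj₂ (proj₁ HB)) x y

  π-trans : ∀ {x y z} → π x y ≡ true → π y z ≡ true → π x z ≡ true
  π-trans {x} {y} {z} = proj₁ (proj₂ (proj₂ (proj₁ HB))) x y z

  π-negate : ∀ x y → π x y ≡ π (negate x) (negate y)
  π-negate = proj₁ (proj₂ (proj₂ (proj₂ (proj₁ HB))))

  π-noncrossing : ∀ a b c d → rank a < rank b → rank b < rank c → rank c < rank d →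
                  π a c ≡ true → π b d ≡ true → π a b ≡ true
  π-noncrossing = proj₂ HB

  π-symᵇ : ∀ x y → π x y ≡ π y x
  π-symᵇ x y = bool-ext π-sym π-sym

  σ : PRel n
  σ = proj₁ (phiB n π)

  X : Fin n → Bool
  X = proj₂ (phiB n π)

  neg-neg : ∀ i j → π (neg i) (neg j) ≡ σ i j
  neg-neg i j = sym (π-negate (pos i) (pos j))

  pos-neg-sym : ∀ i j → π (pos i) (neg j) ≡ π (pos j) (neg i)
  pos-neg-sym i j = trans (π-negate (pos i) (neg j)) (π-symᵇ (neg i) (pos j))

  X-intro : ∀ {i j} → π (pos i) (neg j) ≡ true → X i ≡ true
  X-intro {i} {j} e = any-intro {p = λ k → π (pos i) (neg k)} (allF n) (∈-allFin j) e

  X-witness : ∀ {i} → X i ≡ true → ∃[ j ] (π (pos i) (neg j) ≡ true)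
  X-witness {i} xi with any-witness {p = λ k → π (pos i) (neg k)} (allF n) xi
  ... | j , _ , ij = j , ij

  phi-NCNN : IsNCNN n (σ , X)
  phi-NCNN = (((λ i → π-refl (pos i)) , (λ i j → π-sym) , (λ i j k → π-trans)) , noncrossing) , blockwise , nonnested
    where
    noncrossing : ∀ a b c d → Edge σ a b → Edge σ c d → toℕ a < toℕ c → toℕ c < toℕ b → toℕ b < toℕ d → ⊥
    noncrossing a b c d (_ , ab , gap) (_ , cd , _) a<c c<b b<d =
      true≢false (trans (sym (π-noncrossing (pos a) (pos c) (pos b) (pos d) a<c c<b b<d ab cd)) (gap c a<c c<b))
    blockwise : ∀ i j → σ i j ≡ true → X i ≡ X j
    blockwise i j ij = bool-ext (λ xi → let (k , ik) = X-witness xi in X-intro (π-trans (π-sym ij) ik))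
                                (λ xj → let (k , jk) = X-witness xj in X-intro (π-trans ij jk))
    -- a block B meeting -[n] cannot be nested in an edge (i , j) of σ:
    -- the points i < B < j < -[n] would cross
    nonnested : ∀ r → X r ≡ true → NonNested σ r
    nonnested r xr i j (_ , ij , gap) inside with X-witness xr
    ... | s , rs = true≢false (trans (sym (π-noncrossing (pos i) (pos r) (pos j) (neg s) i<r r<j
                                            (pos<neg j s) ij rs)) (gap r i<r r<j))
      where
      i<r = proj₁ (inside r (π-refl (pos r)))
      r<j = proj₂ (inside r (π-refl (pos r)))

  open XBlocks σ X phi-NCNN public

  -- If the π-block of r meets -[n], it does so in -A for a block A of σ;
  -- mirror r is the maximum of A, a canonical representative of the
  -- X-block facing the X-block of r.
  mirror : Fin n → Fin n
  mirror r = firstWith (λ s → π (pos r) (neg s) ∧ isMaxB σ s) r (allF n)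

  mirror-spec : ∀ {r} → X r ≡ true → π (pos r) (neg (mirror r)) ≡ true × isMaxB σ (mirror r) ≡ true
  mirror-spec {r} xr with X-witness xr
  ... | s₀ , rs₀ with block-max s₀
  ... | m , s₀m , max with firstWith-satisfies (λ s → π (pos r) (neg s) ∧ isMaxB σ s) (allF n) r (∈-allFin m)
                             (∧-intro (π-trans rs₀ (trans (neg-neg s₀ m) s₀m)) max)
  ... | e = ∧-elimˡ e , ∧-elimʳ {π (pos r) (neg (mirror r))} e

  mirror-isXMax : ∀ {r} → X r ≡ true → isXMax (mirror r) ≡ true
  mirror-isXMax {r} xr = ∧-intro (X-intro (trans (pos-neg-sym (mirror r) r) (proj₁ (mirror-spec xr)))) (proj₂ (mirror-spec xr))

  mirror-injective : ∀ {r r'} → isXMax r ≡ true → isXMax r' ≡ true → mirror r ≡ mirror r' → r ≡ r'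
  mirror-injective {r} {r'} xr xr' e = max-unique
    (π-trans (proj₁ (mirror-spec (∧-elimˡ xr))) (π-sym (subst (λ z → π (pos r') (neg z) ≡ true) (sym e) (proj₁ (mirror-spec (∧-elimˡ xr'))))))
    (∧-elimʳ {X r} xr) (∧-elimʳ {X r'} xr')

  -- Fix i ~ -j.  The mirror maps the X-blocks ending before i bijectively
  -- onto the X-blocks after the block of j (noncrossing forbids every other
  -- position); with the X-blocks up to the block of j this counts all k
  -- X-blocks, whence  index i + index j + 1 = k.
  module Linked (i j : Fin n) (i~-j : π (pos i) (neg j) ≡ true) where

    j~-i : π (pos j) (neg i) ≡ true
    j~-i = trans (pos-neg-sym j i) i~-j

    before-i : Fin n → Bool
    before-i r = isXMax r ∧ (toℕ r <ᵇ toℕ i)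

    after-j : Fin n → Bool
    after-j s = isXMax s ∧ ((toℕ j <ᵇ toℕ s) ∧ not (σ j s))

    mirror-after : ∀ {r} → before-i r ≡ true → after-j (mirror r) ≡ true
    mirror-after {r} e = ∧-intro (mirror-isXMax xr) (∧-intro (<ᵇ-complete j<s) (not-intro j≁s))
      where
      xr = ∧-elimˡ {X r} (∧-elimˡ {isXMax r} e)
      r<i = <ᵇ-sound {toℕ r} {toℕ i} (∧-elimʳ {isXMax r} e)
      s = mirror r
      r~-s = proj₁ (mirror-spec xr)
      r≁i : π (pos r) (pos i) ≡ true → ⊥
      r≁i ri = <⇒≱ r<i (isMax-elim (∧-elimʳ {X r} (∧-elimˡ {isXMax r} e)) i ri)
      j≁s : σ j s ≡ false
      j≁s = ≢true⇒false λ js → r≁i (π-trans (π-trans r~-s (trans (neg-neg s j) (σ-sym js))) (π-sym i~-j))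
      j<s : toℕ j < toℕ s
      j<s with <-cmp (toℕ j) (toℕ s)
      ... | tri< j<s _ _ = j<s
      ... | tri≈ _ j≡s _ = ⊥-elim (apart j≁s (σ-refl j) j≡s)
      ... | tri> _ _ s<j = ⊥-elim (r≁i (π-noncrossing (pos r) (pos i) (neg s) (neg j) r<i (pos<neg i s) (+-monoʳ-< n s<j) r~-s i~-j))

    mirror-before : ∀ {y} → after-j y ≡ true → before-i (mirror y) ≡ true × mirror (mirror y) ≡ y
    mirror-before {y} e = ∧-intro (mirror-isXMax xy) (<ᵇ-complete t<i) , involutive
      where
      xy = ∧-elimˡ {X y} (∧-elimˡ {isXMax y} e)
      j<y = <ᵇ-sound {toℕ j} {toℕ y} (∧-elimˡ {toℕ j <ᵇ toℕ y} (∧-elimʳ {isXMax y} e))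
      j≁y = not-elim (∧-elimʳ {toℕ j <ᵇ toℕ y} (∧-elimʳ {isXMax y} e))
      t = mirror y
      y~-t = proj₁ (mirror-spec xy)
      t≁i : σ t i ≡ false
      t≁i = ≢true⇒false λ ti → true≢false (trans (sym (σ-sym (π-trans (π-trans y~-t (trans (neg-neg t i) ti)) (π-sym j~-i)))) j≁y)
      t<i : toℕ t < toℕ i
      t<i with <-cmp (toℕ t) (toℕ i)
      ... | tri< t<i _ _ = t<i
      ... | tri≈ _ t≡i _ = ⊥-elim (apart t≁i (σ-refl t) t≡i)
      ... | tri> _ _ i<t = ⊥-elim (true≢false (trans (sym (π-noncrossing (pos j) (pos y) (neg i) (neg t) j<y (pos<neg y i)
                                                                       (+-monoʳ-< n i<t) j~-i y~-t)) j≁y))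
      t~-y : π (pos t) (neg y) ≡ true
      t~-y = trans (pos-neg-sym t y) y~-t
      involutive : mirror t ≡ y
      involutive = max-unique (trans (sym (neg-neg (mirror t) y)) (π-trans (π-sym (proj₁ (mirror-spec (X-intro t~-y)))) t~-y))
                              (proj₂ (mirror-spec (X-intro t~-y))) (∧-elimʳ {X y} (∧-elimˡ {isXMax y} e))

    index-i≡after-j : index i ≡ count after-j (allF n)
    index-i≡after-j = count-bijection before-i after-j mirror mirror-after
      (λ {x} {x'} e e' → mirror-injective (∧-elimˡ {isXMax x} e) (∧-elimˡ {isXMax x'} e'))
      (λ {y} e → mirror y , proj₁ (mirror-before e) , proj₂ (mirror-before e))

    -- k = (X-blocks before j) + (the block of j) + (X-blocks after it)
    k-split : k ≡ index j + suc (count after-j (allF n))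
    k-split = trans (count-split isXMax (λ r → toℕ r <ᵇ toℕ j) (allF n))
      (cong (index j +_) (trans (count-split (λ r → isXMax r ∧ not (toℕ r <ᵇ toℕ j)) (σ j) (allF n))
        (cong₂ _+_ block-of-j (count-ext later later⁻¹ (allF n)))))
      where
      block-of-j : count (λ r → (isXMax r ∧ not (toℕ r <ᵇ toℕ j)) ∧ σ j r) (allF n) ≡ 1
      block-of-j with X-block-max j (X-intro j~-i)
      ... | m , jm , xm = count-single (allF n) (allFin⁺ n) (∈-allFin m)
            (∧-intro (∧-intro xm (not-intro (≢true⇒false λ m<j → <⇒≱ (<ᵇ-sound {toℕ m} {toℕ j} m<j)
                                                                       (isMax-elim (∧-elimʳ {X m} xm) j (σ-sym jm))))) jm)
            (λ x e → max-unique (σ-trans (σ-sym (∧-elimʳ {isXMax x ∧ not (toℕ x <ᵇ toℕ j)} e)) jm)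
                                (∧-elimʳ {X x} (∧-elimˡ {isXMax x} (∧-elimˡ {isXMax x ∧ not (toℕ x <ᵇ toℕ j)} e)))
                                (∧-elimʳ {X m} xm))
      later : ∀ r → (isXMax r ∧ not (toℕ r <ᵇ toℕ j)) ∧ not (σ j r) ≡ true → after-j r ≡ true
      later r e = ∧-intro (∧-elimˡ {isXMax r} (∧-elimˡ {isXMax r ∧ not (toℕ r <ᵇ toℕ j)} e))
                          (∧-intro (<ᵇ-complete (≤∧≢⇒< j≤r (apart j≁r (σ-refl j)))) (not-intro j≁r))
        where
        j≁r = not-elim (∧-elimʳ {isXMax r ∧ not (toℕ r <ᵇ toℕ j)} e)
        j≤r = ≮⇒≥ (false⇒≢true (not-elim (∧-elimʳ {isXMax r} (∧-elimˡ {isXMax r ∧ not (toℕ r <ᵇ toℕ j)} e))) ∘ <ᵇ-complete)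
      later⁻¹ : ∀ r → after-j r ≡ true → (isXMax r ∧ not (toℕ r <ᵇ toℕ j)) ∧ not (σ j r) ≡ true
      later⁻¹ r e = ∧-intro (∧-intro (∧-elimˡ {isXMax r} e)
                                     (not-intro (≢true⇒false λ r<j → <-asym (<ᵇ-sound {toℕ r} {toℕ j} r<j) j<r)))
                            (∧-elimʳ {toℕ j <ᵇ toℕ r} (∧-elimʳ {isXMax r} e))
        where j<r = <ᵇ-sound {toℕ j} {toℕ r} (∧-elimˡ {toℕ j <ᵇ toℕ r} (∧-elimʳ {isXMax r} e))

    indices-sum : suc (index i + index j) ≡ k
    indices-sum = begin
      suc (index i + index j)                    ≡⟨ cong suc (+-comm (index i) (index j)) ⟩
      suc (index j + index i)                    ≡⟨ sym (+-suc (index j) (index i)) ⟩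
      index j + suc (index i)                    ≡⟨ cong (λ c → index j + suc c) index-i≡after-j ⟩
      index j + suc (count after-j (allF n))     ≡⟨ sym k-split ⟩
      k ∎
      where open ≡-Reasoning

  pos-neg-paired : ∀ i j → π (pos i) (neg j) ≡ Paired i j
  pos-neg-paired i j = bool-ext (λ ij → Paired-intro (X-intro ij) (X-intro (Linked.j~-i i j ij)) (Linked.indices-sum i j ij)) linked
    where
    linked : Paired i j ≡ true → π (pos i) (neg j) ≡ true
    linked e with Paired-elim {i} {j} e
    ... | xi , xj , s with X-witness xi
    ... | j' , ij' = π-trans ij' (trans (neg-neg j' j) (σ-sym (index-injective xj (X-intro (Linked.j~-i i j' ij'))
                        (+-cancelˡ-≡ (index i) _ _ (suc-injective (trans s (sym (Linked.indices-sum i j' ij'))))))))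

Paired-cong : ∀ {n} {σ σ' : PRel n} {X X' : Fin n → Bool} (H : IsNCNN n (σ , X)) (H' : IsNCNN n (σ' , X')) →
  (∀ i j → σ i j ≡ σ' i j) → (∀ i → X i ≡ X' i) → ∀ i j → XBlocks.Paired σ X H i j ≡ XBlocks.Paired σ' X' H' i j
Paired-cong {n} {σ} {σ'} {X} {X'} H H' eσ eX i j =
  cong₂ _∧_ (eX i) (cong₂ _∧_ (eX j) (cong₂ _≡ᵇ_ (cong suc (cong₂ _+_ (same-index i) (same-index j))) same-k))
  where
  module A = XBlocks σ X H
  module B = XBlocks σ' X' H'
  same-isXMax : ∀ r → A.isXMax r ≡ B.isXMax r
  same-isXMax r = cong₂ _∧_ (eX r) (all-cong (λ j → cong (λ b → not b ∨ (toℕ j ≤ᵇ toℕ r)) (eσ r j)) (allF n))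
  same-index : ∀ i → A.index i ≡ B.index i
  same-index i = cong length (filterᵇ-cong (λ r → cong (_∧ (toℕ r <ᵇ toℕ i)) (same-isXMax r)) (allF n))
  same-k : A.k ≡ B.k
  same-k = cong length (filterᵇ-cong same-isXMax (allF n))

-- Injectivity: π is determined by φ(π), since i ~ -j is decided by the pairing.
phi-injective : ∀ n (π π' : BRel n) → IsNCB n π → IsNCB n π' → phiB n π ≈NN phiB n π' → π ≈B π'
phi-injective n π π' h h' (eσ , eX) = same
  where
  module A = TypeB π h
  module B = TypeB π' h'
  pos-neg : ∀ i j → π (pos i) (neg j) ≡ π' (pos i) (neg j)
  pos-neg i j = trans (A.pos-neg-paired i j) (trans (Paired-cong A.phi-NCNN B.phi-NCNN eσ eX i j) (sym (B.pos-neg-paired i j)))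
  same : ∀ x y → π x y ≡ π' x y
  same (pos i) (pos j) = eσ i j
  same (pos i) (neg j) = pos-neg i j
  same (neg i) (pos j) = trans (A.π-symᵇ (neg i) (pos j)) (trans (pos-neg j i) (B.π-symᵇ (pos j) (neg i)))
  same (neg i) (neg j) = trans (A.neg-neg i j) (trans (eσ i j) (sym (B.neg-neg i j)))

module Glue {n : ℕ} (σ : PRel n) (X : Fin n → Bool) (H : IsNCNN n (σ , X)) where
  open XBlocks σ X H

  glued : BRel n
  glued (pos i) (pos j) = σ i j
  glued (pos i) (neg j) = Paired i j
  glued (neg i) (pos j) = Paired j i
  glued (neg i) (neg j) = σ i j

  glued-refl : ∀ x → glued x x ≡ true
  glued-refl (pos i) = σ-refl i
  glued-refl (neg i) = σ-refl i

  glued-sym : ∀ x y → glued x y ≡ true → glued y x ≡ true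
  glued-sym (pos i) (pos j) e = σ-sym e
  glued-sym (pos i) (neg j) e = e
  glued-sym (neg i) (pos j) e = e
  glued-sym (neg i) (neg j) e = σ-sym e

  glued-trans : ∀ x y z → glued x y ≡ true → glued y z ≡ true → glued x z ≡ true
  glued-trans (pos i) (pos j) (pos k) a b = σ-trans a b
  glued-trans (pos i) (pos j) (neg k) a b = Paired-left (σ-sym a) b
  glued-trans (pos i) (neg j) (pos k) a b = Paired-unique (trans (Paired-sym j i) a) (trans (Paired-sym j k) b)
  glued-trans (pos i) (neg j) (neg k) a b = Paired-right b a
  glued-trans (neg i) (pos j) (pos k) a b = Paired-left b a
  glued-trans (neg i) (pos j) (neg k) a b = Paired-unique a b
  glued-trans (neg i) (neg j) (pos k) a b = Paired-right (σ-sym a) b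
  glued-trans (neg i) (neg j) (neg k) a b = σ-trans a b

  glued-negate : ∀ x y → glued x y ≡ glued (negate x) (negate y)
  glued-negate (pos i) (pos j) = refl
  glued-negate (pos i) (neg j) = Paired-sym i j
  glued-negate (neg i) (pos j) = Paired-sym j i
  glued-negate (neg i) (neg j) = refl

  -- the zero block is the self-paired middle block, which is unique
  glued-zero : ∀ x y → glued x (negate x) ≡ true → glued y (negate y) ≡ true → glued x y ≡ true
  glued-zero (pos i) (pos j) ii jj = self-paired-unique ii jj
  glued-zero (pos i) (neg j) ii jj = Paired-right (self-paired-unique ii jj) ii
  glued-zero (neg i) (pos j) ii jj = trans (Paired-sym j i) (Paired-right (self-paired-unique ii jj) ii)
  glued-zero (neg i) (neg j) ii jj = self-paired-unique ii jj

  X-block-not-inside : ∀ {a b c} → X b ≡ true → σ a c ≡ true → toℕ a < toℕ b → toℕ b < toℕ c → σ a b ≡ true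
  X-block-not-inside {a} {b} xb ac a<b b<c with σ a b in ab
  ... | true = refl
  ... | false with nested-inside-edge ac ab a<b b<c
  ...   | e , f , edge , inside = ⊥-elim (X-nonnested b xb e f edge inside)

  pairs-nest : ∀ {a b c d} → Paired a c ≡ true → Paired b d ≡ true → toℕ a < toℕ b → toℕ c < toℕ d → σ a b ≡ true
  pairs-nest {a} {b} {c} {d} ac bd a<b c<d with σ a b in ab | Paired-elim {a} {c} ac | Paired-elim {b} {d} bd
  ... | true | _ | _ = refl
  ... | false | xa , xc , sac | xb , xd , sbd = ⊥-elim (<-irrefl (suc-injective (trans sac (sym sbd)))
                                                          (+-mono-<-≤ (index-strict xa xb ab a<b) index-c≤d))
    where
    index-c≤d : index c ≤ index d
    index-c≤d with σ c d in cd
    ... | true = ≤-reflexive (index-blockwise xc cd)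
    ... | false = <⇒≤ (index-strict xc xd cd c<d)

  glued-noncrossing : ∀ a b c d → rank a < rank b → rank b < rank c → rank c < rank d →
                      glued a c ≡ true → glued b d ≡ true → glued a b ≡ true
  glued-noncrossing (pos a) (pos b) (pos c) (pos d) ab bc cd ac bd = noncrossing-4 ac bd ab bc cd
  glued-noncrossing (pos a) (pos b) (pos c) (neg d) ab bc cd ac bd = X-block-not-inside (proj₁ (Paired-elim {b} {d} bd)) ac ab bc
  glued-noncrossing (pos a) (pos b) (neg c) (neg d) ab bc cd ac bd = pairs-nest ac bd ab (+-cancelˡ-< n (toℕ c) (toℕ d) cd)
  glued-noncrossing (pos a) (neg b) (neg c) (neg d) ab bc cd ac bd =
    trans (Paired-sym a b) (Paired-left (σ-sym b~c) (trans (Paired-sym c a) ac))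
    where
    b~c = X-block-not-inside (proj₁ (proj₂ (Paired-elim {a} {c} ac))) bd
            (+-cancelˡ-< n (toℕ b) (toℕ c) bc) (+-cancelˡ-< n (toℕ c) (toℕ d) cd)
  glued-noncrossing (neg a) (neg b) (neg c) (neg d) ab bc cd ac bd =
    noncrossing-4 ac bd (+-cancelˡ-< n (toℕ a) (toℕ b) ab) (+-cancelˡ-< n (toℕ b) (toℕ c) bc) (+-cancelˡ-< n (toℕ c) (toℕ d) cd)
  glued-noncrossing (neg a) (pos b) c d ab bc cd ac bd = ⊥-elim (neg⊀pos a b ab)
  glued-noncrossing (pos a) (neg b) (pos c) d ab bc cd ac bd = ⊥-elim (neg⊀pos b c bc)
  glued-noncrossing (pos a) (pos b) (neg c) (pos d) ab bc cd ac bd = ⊥-elim (neg⊀pos c d cd)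
  glued-noncrossing (pos a) (neg b) (neg c) (pos d) ab bc cd ac bd = ⊥-elim (neg⊀pos c d cd)
  glued-noncrossing (neg a) (neg b) (pos c) d ab bc cd ac bd = ⊥-elim (neg⊀pos b c bc)
  glued-noncrossing (neg a) (neg b) (neg c) (pos d) ab bc cd ac bd = ⊥-elim (neg⊀pos c d cd)

  glued-NCB : IsNCB n glued
  glued-NCB = (glued-refl , glued-sym , glued-trans , glued-negate , glued-zero) , glued-noncrossing

  -- φ(glued) = (σ , X): a block meets -[n] iff it is an X-block (which has a partner)
  glued-phi : phiB n glued ≈NN (σ , X)
  glued-phi = (λ i j → refl) , λ i → bool-ext
    (λ e → let (k , _ , ik) = any-witness {p = Paired i} (allF n) e in proj₁ (Paired-elim {i} {k} ik))
    (λ xi → let (t , _ , it) = partner xi in any-intro {p = Paired i} (allF n) (∈-allFin t) it)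

phi-surjective : ∀ n (d : NNData n) → IsNCNN n d → Σ (BRel n) (λ π → IsNCB n π × (phiB n π ≈NN d))
phi-surjective n (σ , X) H = Glue.glued σ X H , Glue.glued-NCB σ X H , Glue.glued-phi σ X H

-- Each pair {B , -B} of nonzero blocks of π is
-- represented by its ≺-least element, which is positive: either the
-- minimum of a block of σ \ X (then B is that block), or the minimum of an
-- X-block A_{p+1} in the first half, 2p + 1 < k (then B = A_{p+1} ∪ -A_{k-p}).
module TypeFormula {n : ℕ} (π : BRel n) (HB : IsNCB n π) (n≥1 : 1 ≤ n) where
  open TypeB π HB

  restMin : Fin n → Bool
  restMin r = not (X r) ∧ isMinB σ r

  firstHalfMin : Fin n → Bool
  firstHalfMin r = (X r ∧ isMinB σ r) ∧ (suc (index r + index r) <ᵇ k)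

  restMin-X : ∀ {r} → restMin r ≡ true → X r ≡ false
  restMin-X {r} e = not-elim (∧-elimˡ {not (X r)} e)

  restMin-min : ∀ {r} → restMin r ≡ true → isMinB σ r ≡ true
  restMin-min {r} e = ∧-elimʳ {not (X r)} e

  firstHalf-X : ∀ {r} → firstHalfMin r ≡ true → X r ≡ true
  firstHalf-X {r} e = ∧-elimˡ {X r} (∧-elimˡ {X r ∧ isMinB σ r} e)

  firstHalf-min : ∀ {r} → firstHalfMin r ≡ true → isMinB σ r ≡ true
  firstHalf-min {r} e = ∧-elimʳ {X r} (∧-elimˡ {X r ∧ isMinB σ r} e)

  firstHalf-< : ∀ {r} → firstHalfMin r ≡ true → suc (index r + index r) < k
  firstHalf-< {r} e = <ᵇ-sound {suc (index r + index r)} {k} (∧-elimʳ {X r ∧ isMinB σ r} e)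

  pairRep-elim : ∀ {x} → isPairRep π x ≡ true →
                 π x (negate x) ≡ false × (∀ y → π x y ∨ π (negate x) y ≡ true → rank x ≤ rank y)
  pairRep-elim {x} e = not-elim (∧-elimˡ e) , least
    where
    least : ∀ y → π x y ∨ π (negate x) y ≡ true → rank x ≤ rank y
    least y xy with ∨-elim (all-elim {p = λ y → not (π x y ∨ π (negate x) y) ∨ (rank x ≤ᵇ rank y)} (allPM n) (∈-allPM y)
                                     (∧-elimʳ {not (π x (negate x))} e))
      where
      ∈-allPM : ∀ y → y ∈ allPM n
      ∈-allPM (pos i) = ∈-++⁺ˡ (∈-map⁺ pos (∈-allFin i))
      ∈-allPM (neg i) = ∈-++⁺ʳ (map pos (allF n)) (∈-map⁺ neg (∈-allFin i))
    ... | inj₁ x≁y = ⊥-elim (true≢false (trans (sym xy) (not-elim x≁y)))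
    ... | inj₂ x≤y = ≤ᵇ-sound x≤y

  pairRep-intro : ∀ {x} → π x (negate x) ≡ false → (∀ y → π x y ∨ π (negate x) y ≡ true → rank x ≤ rank y) →
                  isPairRep π x ≡ true
  pairRep-intro {x} nonzero least = ∧-intro (not-intro nonzero) (all-intro (allPM n) (λ y _ → test y))
    where
    test : ∀ y → not (π x y ∨ π (negate x) y) ∨ (rank x ≤ᵇ rank y) ≡ true
    test y with π x y ∨ π (negate x) y in xy
    ... | true = ≤ᵇ-complete (least y xy)
    ... | false = refl

  -- a negative point is never the least point of B ∪ -B: its negation is smaller
  neg-not-rep : ∀ j → isPairRep π (neg j) ≡ false
  neg-not-rep j = ≢true⇒false λ e → <⇒≱ (≤-trans (s≤s (m≤n+m (toℕ j) 0)) (+-monoˡ-≤ (toℕ j) n≥1))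
                                          (proj₂ (pairRep-elim e) (pos j) (∨-introʳ {π (neg j) (pos j)} (π-refl (pos j))))

  neg-in-block : ∀ {r t} → π (neg r) (pos t) ≡ true → Paired t r ≡ true
  neg-in-block {r} {t} e = trans (sym (pos-neg-paired t r)) (trans (π-symᵇ (pos t) (neg r)) e)

  rep-is-min : ∀ {r} → isPairRep π (pos r) ≡ true → isMinB σ r ≡ true
  rep-is-min e = isMin-intro (λ j rj → proj₂ (pairRep-elim e) (pos j) (∨-introˡ rj))

  rep-first-half : ∀ r → isPairRep π (pos r) ≡ true → X r ≡ true → suc (index r + index r) < k
  rep-first-half r e xr with <-cmp (suc (index r + index r)) k | pairRep-elim e
  ... | tri< lt _ _ | _ = lt
  ... | tri≈ _ eq _ | nonzero , _ = ⊥-elim (true≢false (trans (sym (trans (pos-neg-paired r r) (Paired-intro xr xr eq))) nonzero))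
  ... | tri> _ _ gt | _ , least with partner xr
  ...   | t , xt , rt with Paired-elim {r} {t} rt
  ...     | _ , _ , s = ⊥-elim earlier-partner
    where
    -- the partner A_{k-p} of A_{p+1} would come before it, yet contain no point before r
    it<ir : index t < index r
    it<ir = +-cancelˡ-< (index r) (index t) (index r) (s≤s⁻¹ (subst (_< suc (index r + index r)) (sym s) gt))
    r≤t : toℕ r ≤ toℕ t
    r≤t = least (pos t) (∨-introʳ {π (pos r) (pos t)} (trans (sym (π-symᵇ (pos t) (neg r)))
                                  (trans (pos-neg-paired t r) (trans (Paired-sym t r) rt))))
    earlier-partner : ⊥
    earlier-partner with σ r t in r~t
    ... | true = <-irrefl (sym (index-blockwise xr r~t)) it<ir
    ... | false = <-asym it<ir (index-strict xr (∧-elimˡ {X t} xt) r~t (≤∧≢⇒< r≤t (apart r~t (σ-refl r))))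

  rep-from-min : ∀ r → isMinB σ r ≡ true → π (pos r) (neg r) ≡ false →
                 (∀ t → Paired t r ≡ true → toℕ r ≤ toℕ t) → isPairRep π (pos r) ≡ true
  rep-from-min r min nonzero paired-after = pairRep-intro nonzero least
    where
    least : ∀ y → π (pos r) y ∨ π (neg r) y ≡ true → toℕ r ≤ rank y
    least (neg j) _ = <⇒≤ (pos<neg r j)
    least (pos j) e with ∨-elim {π (pos r) (pos j)} e
    ... | inj₁ rj = isMin-elim min j rj
    ... | inj₂ -rj = paired-after j (neg-in-block -rj)

  pos-rep : ∀ r → isPairRep π (pos r) ≡ restMin r ∨ firstHalfMin r
  pos-rep r = bool-ext forward backward
    where
    forward : isPairRep π (pos r) ≡ true → restMin r ∨ firstHalfMin r ≡ true
    forward e with bool-cases (X r)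
    ... | inj₁ xr = ∨-introʳ {restMin r} (∧-intro (∧-intro xr (rep-is-min e)) (<ᵇ-complete (rep-first-half r e xr)))
    ... | inj₂ xr = ∨-introˡ (∧-intro (not-intro xr) (rep-is-min e))
    backward : restMin r ∨ firstHalfMin r ≡ true → isPairRep π (pos r) ≡ true
    backward e with ∨-elim {restMin r} e
    ... | inj₁ rest = rep-from-min r (restMin-min rest)
                        (any-false {p = λ t → π (pos r) (neg t)} (allF n) (∈-allFin r) (restMin-X rest))
                        (λ t tr → ⊥-elim (true≢false (trans (sym (proj₁ (proj₂ (Paired-elim {t} {r} tr)))) (restMin-X rest))))
    ... | inj₂ half = rep-from-min r (firstHalf-min half) nonzero paired-after
      where
      xr = firstHalf-X half
      lt = firstHalf-< half
      nonzero : π (pos r) (neg r) ≡ false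
      nonzero = ≢true⇒false λ rr → <-irrefl (proj₂ (proj₂ (Paired-elim {r} {r} (trans (sym (pos-neg-paired r r)) rr)))) lt
      paired-after : ∀ t → Paired t r ≡ true → toℕ r ≤ toℕ t
      paired-after t tr with ≤-<-connex (toℕ r) (toℕ t) | Paired-elim {t} {r} tr
      ... | inj₁ r≤t | _ = r≤t
      ... | inj₂ t<r | xt , _ , s with σ t r in t~r
      ...   | true = ⊥-elim (<-irrefl (trans (sym (cong (λ z → suc (z + index r)) (index-blockwise xt t~r))) s) lt)
      ...   | false = ⊥-elim (<-asym lt (subst (_< suc (index r + index r)) s
                                              (s≤s (+-monoˡ-< (index r) (index-strict xt xr t~r t<r)))))

  size : PM n → ℕ
  size x = length (filterᵇ (π x) (allPM n))

  size-pos : ∀ r → size (pos r) ≡ blockSize σ r + count (λ j → π (pos r) (neg j)) (allF n)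
  size-pos r = trans (count-++ (π (pos r)) (map pos (allF n)) (map neg (allF n)))
                     (cong₂ _+_ (count-map pos (π (pos r)) (allF n)) (count-map neg (π (pos r)) (allF n)))

  typeB-reps : typeB π ≡ map (size ∘ pos) (filterᵇ (λ r → restMin r ∨ firstHalfMin r) (allF n))
  typeB-reps = begin
    map size (filterᵇ (isPairRep π) (map pos (allF n) ++ map neg (allF n)))
      ≡⟨ cong (map size) (filter-++ (T? ∘ isPairRep π) (map pos (allF n)) (map neg (allF n))) ⟩
    map size (filterᵇ (isPairRep π) (map pos (allF n)) ++ filterᵇ (isPairRep π) (map neg (allF n)))
      ≡⟨ cong (map size) (cong₂ _++_ (trans (filterᵇ-map pos (isPairRep π) (allF n)) (cong (map pos) (filterᵇ-cong pos-rep (allF n))))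
                                      (trans (filterᵇ-map neg (isPairRep π) (allF n)) (cong (map neg) no-neg-reps))) ⟩
    map size (map pos (filterᵇ (λ r → restMin r ∨ firstHalfMin r) (allF n)) ++ [])
      ≡⟨ cong (map size) (++-identityʳ _) ⟩
    map size (map pos (filterᵇ (λ r → restMin r ∨ firstHalfMin r) (allF n)))
      ≡⟨ sym (map-∘ (filterᵇ (λ r → restMin r ∨ firstHalfMin r) (allF n))) ⟩
    map (size ∘ pos) (filterᵇ (λ r → restMin r ∨ firstHalfMin r) (allF n)) ∎
    where
    open ≡-Reasoning
    no-neg-reps : filterᵇ (isPairRep π ∘ neg) (allF n) ≡ []
    no-neg-reps = trans (filterᵇ-cong neg-not-rep (allF n)) (filter-false (allF n))
      where
      filter-false : ∀ xs → filterᵇ (λ _ → false) xs ≡ []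
      filter-false [] = refl
      filter-false (_ ∷ xs) = filter-false xs

  -- blocks of σ \ X are blocks of π
  rest-sizes : map (size ∘ pos) (filterᵇ restMin (allF n)) ≡ typeRest (phiB n π)
  rest-sizes = map-cong-local (All-tabulate λ {r} r∈ → trans (size-pos r)
    (trans (cong (blockSize σ r +_) (count-none (allF n) (λ j _ → any-false {p = λ t → π (pos r) (neg t)} (allF n) (∈-allFin j)
                                                          (restMin-X (∈-filter-allF⁻ r∈)))))
           (+-identityʳ _)))

  d₀ : Fin n
  d₀ = Fin.fromℕ< n≥1

  L : List (Fin n)
  L = filterᵇ isXMax (allF n)

  outerSize : ℕ → ℕ
  outerSize p = unionSize σ (at d₀ L p , at d₀ L (k ∸ suc p))

  L-at-index : ∀ t → isXMax t ≡ true → at d₀ L (index t) ≡ t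
  L-at-index t xt = cong (Maybe.fromMaybe d₀) (filter-position n isXMax t xt)

  Tpart-outer : Tpart (phiB n π) ≡ map outerSize (upTo (k / 2))
  Tpart-outer = trans by-parity (sym (map-∘ (upTo (k / 2))))
    where
    by-parity : Tpart (phiB n π) ≡ map (unionSize σ) (outerPairs d₀ L (k / 2))
    by-parity with parity k
    ... | inj₁ (even , e) = trans (cong (λ b → if b then pairing σ L else pairing σ (dropMiddle L)) even)
                                  (cong (map (unionSize σ)) (pairUp-even d₀ L (k / 2) e))
    ... | inj₂ (odd , e) = trans (cong (λ b → if b then pairing σ L else pairing σ (dropMiddle L)) odd)
                                 (cong (map (unionSize σ)) (pairUp-odd d₀ L (k / 2) e))

  -- the block of a first-half representative r is A_{p+1} ∪ -A_{k-p}, p = index r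
  outerSize-index : ∀ r → firstHalfMin r ≡ true → outerSize (index r) ≡ size (pos r)
  outerSize-index r half with X-block-max r (firstHalf-X half) | partner (firstHalf-X half)
  ... | m , rm , xm | t , xt , rt = begin
    unionSize σ (at d₀ L (index r) , at d₀ L (k ∸ suc (index r)))
      ≡⟨ cong₂ (λ a b → unionSize σ (a , b)) (trans (cong (at d₀ L) (index-blockwise xr rm)) (L-at-index m xm))
                                             (trans (cong (at d₀ L) partner-index) (L-at-index t xt)) ⟩
    count (λ j → σ m j ∨ σ t j) (allF n)
      ≡⟨ count-disjoint-∨ (σ m) (σ t) disjoint (allF n) ⟩
    count (σ m) (allF n) + count (σ t) (allF n)
      ≡⟨ cong₂ _+_ (count-ext (λ j → σ-trans rm) (λ j → σ-trans (σ-sym rm)) (allF n))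
                   (count-ext (λ j e → trans (pos-neg-paired r j) (Paired-right e rt))
                              (λ j e → Paired-unique rt (trans (sym (pos-neg-paired r j)) e)) (allF n)) ⟩
    blockSize σ r + count (λ j → π (pos r) (neg j)) (allF n)
      ≡⟨ sym (size-pos r) ⟩
    size (pos r) ∎
    where
    open ≡-Reasoning
    xr = firstHalf-X half
    lt = firstHalf-< half
    sum = proj₂ (proj₂ (Paired-elim {r} {t} rt))
    partner-index : k ∸ suc (index r) ≡ index t
    partner-index = trans (cong (_∸ suc (index r)) (sym sum)) (m+n∸m≡n (suc (index r)) (index t))
    disjoint : ∀ j → σ m j ≡ true → σ t j ≡ true → ⊥
    disjoint j mj tj = <-irrefl (trans (cong (λ z → suc (index r + z)) (index-blockwise xr (σ-trans rm (σ-trans mj (σ-sym tj))))) sum) lt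

  -- index is a bijection from first-half representatives onto [0 , ⌊k/2⌋)
  first-half-sizes : map (size ∘ pos) (filterᵇ firstHalfMin (allF n)) ↭ map outerSize (upTo (k / 2))
  first-half-sizes = ↭-from-bijection (size ∘ pos) outerSize index (filterᵇ firstHalfMin (allF n)) (upTo (k / 2))
    (unique-filter-allF firstHalfMin) (upTo⁺ (k / 2))
    (λ {r} r∈ → ∈-upTo⁺ (double<⇒<half k (index r) (firstHalf-< (∈-filter-allF⁻ r∈))))
    (λ {r} {r'} r∈ r'∈ e → let h = ∈-filter-allF⁻ r∈ ; h' = ∈-filter-allF⁻ r'∈ in
       min-unique (index-injective (firstHalf-X h) (firstHalf-X h') e) (firstHalf-min h) (firstHalf-min h'))
    onto
    (λ {r} r∈ → outerSize-index r (∈-filter-allF⁻ r∈))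
    where
    onto : ∀ {p} → p ∈ upTo (k / 2) → ∃[ r ] (r ∈ filterᵇ firstHalfMin (allF n) × index r ≡ p)
    onto {p} p∈ with index-onto p (<-trans (s≤s (m≤m+n p p)) (<half⇒double< k p (∈-upTo⁻ p∈)))
    ... | t , xt , it with block-min t
    ... | r , tr , min = r , ∈-filter-allF⁺ (∧-intro (∧-intro xr min) (<ᵇ-complete (subst (λ z → suc (z + z) < k) (sym ir)
                                                                                        (<half⇒double< k p (∈-upTo⁻ p∈))))) , ir
      where
      xr = trans (sym (X-blockwise tr)) (∧-elimˡ {X t} xt)
      ir = trans (sym (index-blockwise (∧-elimˡ {X t} xt) tr)) it

  type-formula : typeB π ↭ (typeRest (phiB n π) ++ Tpart (phiB n π))
  type-formula = begin
    typeB π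
      ≡⟨ typeB-reps ⟩
    map (size ∘ pos) (filterᵇ (λ r → restMin r ∨ firstHalfMin r) (allF n))
      ↭⟨ ↭-map⁺ (size ∘ pos) (filterᵇ-∨-↭ restMin firstHalfMin disjoint (allF n)) ⟩
    map (size ∘ pos) (filterᵇ restMin (allF n) ++ filterᵇ firstHalfMin (allF n))
      ≡⟨ map-++ (size ∘ pos) (filterᵇ restMin (allF n)) (filterᵇ firstHalfMin (allF n)) ⟩
    map (size ∘ pos) (filterᵇ restMin (allF n)) ++ map (size ∘ pos) (filterᵇ firstHalfMin (allF n))
      ↭⟨ ↭-++⁺ (↭-reflexive rest-sizes) (↭-trans first-half-sizes (↭-reflexive (sym Tpart-outer))) ⟩
    typeRest (phiB n π) ++ Tpart (phiB n π) ∎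
    where
    open PermutationReasoning
    disjoint : ∀ r → restMin r ≡ true → firstHalfMin r ≡ true → ⊥
    disjoint r rest half = true≢false (trans (sym (firstHalf-X half)) (restMin-X rest))

proposition4p3 : (n : ℕ) → 1 ≤ n →
    ((π : BRel n) → IsNCB n π → IsNCNN n (phiB n π)) ×
    ((π π' : BRel n) → IsNCB n π → IsNCB n π' →
       phiB n π ≈NN phiB n π' → π ≈B π') ×
    ((d : NNData n) → IsNCNN n d →
       Σ (BRel n) (λ π → IsNCB n π × (phiB n π ≈NN d))) ×
    ((π : BRel n) → IsNCB n π →
       typeB π ↭ (typeRest (phiB n π) ++ Tpart (phiB n π)))
proposition4p3 n n≥1 =
  (λ π h → TypeB.phi-NCNN π h) ,
  phi-injective n ,
  phi-surjective n ,
  (λ π h → TypeFormula.type-formula π h n≥1)
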